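{- Let $q$ be a prime power, let $F$ be a field containing $\mathbb{F}_q$, and let $f(z)=\sum_{i\ge 0} f_i z^{q^i}\in F[[z]]$. Write $a(z)=zf'(z)/(1-f(z))=\sum_{i\ge 0} a_iz^i\in F[[z]]$. Then for every integer $s$ with $1\le s<q$, every integer $k\ge 1$, and all integers $k_1,\dots,k_s$ with $0\le k_i<k$, $$\prod_{i=1}^s a_{q^k-q^{k_i}} = f_0^{(s-1)q^k}\, a_{q^k-\sum_{i=1}^s q^{k_i}}.$$
   Context: Here $f'$ is the formal derivative, so $f'(z)=f_0$ and $a(z)=f_0z/(1-f(z))$. -}

module Defs where

open import Level using (_⊔_)
open import Algebra.Bundles using (CommutativeRing)
open import Data.Nat as ℕ using (ℕ; zero; suc)
open import Data.Fin as F using (Fin)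
open import Data.Product using (∃; _×_)
open import Relation.Nullary using (¬_; yes; no)
open import Relation.Binary.PropositionalEquality using (_≡_)

record IsFieldR {c ℓ} (R : CommutativeRing c ℓ) : Set (c ⊔ ℓ) where
  open CommutativeRing R hiding (zero)
  field
    0≉1 : ¬ (0# ≈ 1#)
    inverse : ∀ x → ¬ (x ≈ 0#) → ∃ λ y → x * y ≈ 1#

module _ {c ℓ} (R : CommutativeRing c ℓ) where
  open CommutativeRing R hiding (zero)

  -- F contains a subfield with exactly q elements (i.e. a copy of F_q):
  -- an injective family Fin q → F whose image is closed under the field operations.
  record HasSubfieldOfSize (q : ℕ) : Set (c ⊔ ℓ) where
    field
      emb      : Fin q → Carrier
      emb-inj  : ∀ i j → emb i ≈ emb j → i ≡ j
      has-0    : ∃ λ i → emb i ≈ 0#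
      has-1    : ∃ λ i → emb i ≈ 1#
      clos-+   : ∀ i j → ∃ λ k → emb i + emb j ≈ emb k
      clos-*   : ∀ i j → ∃ λ k → emb i * emb j ≈ emb k
      clos-neg : ∀ i → ∃ λ k → - emb i ≈ emb k
      clos-inv : ∀ i → ¬ (emb i ≈ 0#) → ∃ λ j → emb i * emb j ≈ 1#

  ι : ℕ → Carrier
  ι zero    = 0#
  ι (suc n) = 1# + ι n

  pow : Carrier → ℕ → Carrier
  pow x zero    = 1#
  pow x (suc n) = x * pow x n

  sumTo : (ℕ → Carrier) → ℕ → Carrier
  sumTo g zero    = g zero
  sumTo g (suc n) = sumTo g n + g (suc n)

  prodFin : ∀ s → (Fin s → Carrier) → Carrier
  prodFin zero    g = 1#
  prodFin (suc s) g = g F.zero * prodFin s (λ i → g (F.suc i))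

  -- Formal power series are coefficient sequences ℕ → Carrier.
  -- Coefficients of f(z) = Σ_i f_i z^(q^i):  coeff n = Σ_{i ≤ n} [q^i = n] f_i
  -- (for q ≥ 2 at most one i contributes).
  qSeries : ℕ → (ℕ → Carrier) → ℕ → Carrier
  qSeries q f n = sumTo (λ i → term i (q ℕ.^ i ℕ.≟ n)) n
    where
    term : ∀ i → _ → Carrier
    term i (yes _) = f i
    term i (no _)  = 0#

  _⋆_ : (ℕ → Carrier) → (ℕ → Carrier) → ℕ → Carrier
  (g ⋆ h) n = sumTo (λ j → g j * h (n ℕ.∸ j)) n

  oneMinus : (ℕ → Carrier) → ℕ → Carrier
  oneMinus g zero    = 1# - g zero
  oneMinus g (suc n) = - g (suc n)

  -- z g'(z) where g' is the formal derivative: coefficient n is n · g_n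
  zDeriv : (ℕ → Carrier) → ℕ → Carrier
  zDeriv g n = ι n * g n

sumFinℕ : ∀ s → (Fin s → ℕ) → ℕ
sumFinℕ zero    g = 0
sumFinℕ (suc s) g = g F.zero ℕ.+ sumFinℕ s (λ i → g (F.suc i))

-- F has characteristic p, being an extension of F_q, so the q-power Frobenius acts on F[[z]]
-- and G(z)^(qⁱ) = ∑ gⱼ^(qⁱ) z^(q^(i+j)) for an additive series G.
--
-- Suppose first that f₀ is a unit, let Q = q^k and let G = ∑ gⱼ z^(qʲ) be the compositional
-- inverse of f modulo z^Q. As G′ = g₀ is constant, Lagrange inversion (here an induction on the
-- recurrence a = f₀ z + a f) gives aₙ = f₀^Q τ(Q - n) for 0 < n < Q, where τ(Y) is the sum of the
-- coefficients of G^Y below Q; the one extra ingredient is [z^(Q-1)] G^Y = 0 for Y ≤ Q - 2, a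
-- computation with residues mod p. Below Q the series G^(qᵉ) lives in degrees ≤ Q / q, so no
-- product of fewer than q of them reaches degree Q and τ(q^k₁ + ⋯ + q^kₛ) = τ(q^k₁) ⋯ τ(q^kₛ),
-- which is the formula.
--
-- A constructive field cannot decide whether f₀ is a unit. Instead, replace fₑ by
-- [e = 0] + fₑ w^(qᵉ) in F[[w]], where the new f₀ = 1 + f₀ w is a unit: the new aₙ has w-degree
-- at most n with leading coefficient the old aₙ, and comparing leading coefficients of the
-- formula over F[[w]] gives the formula over F.

module Submission where

open import Defs
open import Algebra.Bundles using (CommutativeRing)
open import Algebra.Structures using (IsCommutativeRing)
import Algebra.Construct.Pointwise as Pointwise
import Algebra.Properties.AbelianGroup as AbelianGroupProperties
open import Data.Nat as ℕ using (ℕ; zero; suc; _≤_; _<_; z≤n; s≤s; _≟_; _∸_; _!; NonZero)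
import Data.Nat.Properties as ℕ
open import Data.Nat.Tactic.RingSolver using (solve-∀)
open import Data.Nat.Divisibility using (_∣_; divides; _∣?_; ∣⇒≤; ∣-trans; m∣m*n)
open import Data.Nat.DivMod using (m/n*n≡m)
open import Data.Nat.Combinatorics using (_C_; nCk≡n!/k![n-k]!; k![n∸k]!∣n!; nCn≡1)
open import Data.Nat.Primality using (Prime; euclidsLemma; prime⇒nonTrivial)
open import Data.Fin as Fin using (Fin; toℕ; fromℕ)
import Data.Fin.Properties as Fin
open import Data.Fin.Permutation using (Permutation; permutation)
open import Data.Product using (_,_; proj₁; proj₂; ∃)
open import Data.Sum using (inj₁; inj₂)
open import Data.Empty using (⊥-elim)
open import Function using (_∘_)
open import Level using (0ℓ)
open import Relation.Nullary using (yes; no; ¬_; Dec)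
open import Relation.Nullary.Decidable using (map′)
open import Relation.Unary using (Pred; Decidable; _⊆_)
open import Relation.Binary using (tri<; tri≈; tri>)
open import Relation.Binary.PropositionalEquality as ≡ using (_≡_; _≢_)

module FiniteSums {c ℓ} (R : CommutativeRing c ℓ) where

  open CommutativeRing R hiding (zero)
  open AbelianGroupProperties +-abelianGroup using (⁻¹-∙-comm; ε⁻¹≈ε)

  sumBelow : ℕ → (ℕ → Carrier) → Carrier
  sumBelow zero    g = 0#
  sumBelow (suc n) g = sumBelow n g + g n

  syntax sumBelow n (λ j → e) = ∑[ j < n ] e

  ∑-cong : ∀ {g h} n → (∀ j → j < n → g j ≈ h j) → sumBelow n g ≈ sumBelow n h
  ∑-cong zero    _  = refl
  ∑-cong (suc n) eq = +-cong (∑-cong n λ j j<n → eq j (ℕ.m<n⇒m<1+n j<n)) (eq n ℕ.≤-refl)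

  ∑-cong′ : ∀ {g h} n → (∀ j → g j ≈ h j) → sumBelow n g ≈ sumBelow n h
  ∑-cong′ n eq = ∑-cong n λ j _ → eq j

  ∑-zero : ∀ {g} n → (∀ j → j < n → g j ≈ 0#) → sumBelow n g ≈ 0#
  ∑-zero zero    _  = refl
  ∑-zero (suc n) eq =
    trans (+-cong (∑-zero n λ j j<n → eq j (ℕ.m<n⇒m<1+n j<n)) (eq n ℕ.≤-refl)) (+-identityˡ 0#)

  ∑-distrib-+ : ∀ g h n → (∑[ j < n ] (g j + h j)) ≈ sumBelow n g + sumBelow n h
  ∑-distrib-+ g h zero    = sym (+-identityˡ 0#)
  ∑-distrib-+ g h (suc n) = trans (+-congʳ (∑-distrib-+ g h n)) (interchange _ _ _ _)
    where open import Algebra.Properties.CommutativeSemigroup +-commutativeSemigroup using (interchange)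

  *-distribˡ-∑ : ∀ x g n → x * sumBelow n g ≈ (∑[ j < n ] (x * g j))
  *-distribˡ-∑ x g zero    = zeroʳ x
  *-distribˡ-∑ x g (suc n) = trans (distribˡ x _ _) (+-congʳ (*-distribˡ-∑ x g n))

  *-distribʳ-∑ : ∀ x g n → sumBelow n g * x ≈ (∑[ j < n ] (g j * x))
  *-distribʳ-∑ x g zero    = zeroˡ x
  *-distribʳ-∑ x g (suc n) = trans (distribʳ x _ _) (+-congʳ (*-distribʳ-∑ x g n))

  ∑-neg : ∀ g n → (∑[ j < n ] (- g j)) ≈ - sumBelow n g
  ∑-neg g zero    = sym ε⁻¹≈ε
  ∑-neg g (suc n) = trans (+-congʳ (∑-neg g n)) (⁻¹-∙-comm _ _)

  ∑-single : ∀ g n i → i < n → (∀ j → j < n → j ≢ i → g j ≈ 0#) → sumBelow n g ≈ g i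
  ∑-single g (suc n) i i<1+n others with i ≟ n
  ... | yes ≡.refl =
    trans (+-congʳ (∑-zero n λ j j<n → others j (ℕ.m<n⇒m<1+n j<n) (ℕ.<⇒≢ j<n))) (+-identityˡ _)
  ... | no i≢n =
    trans (+-cong (∑-single g n i (ℕ.≤∧≢⇒< (ℕ.≤-pred i<1+n) i≢n) λ j j<n → others j (ℕ.m<n⇒m<1+n j<n))
                  (others n ℕ.≤-refl (i≢n ∘ ≡.sym)))
          (+-identityʳ _)

  ∑-comm : ∀ (h : ℕ → ℕ → Carrier) m n →
           (∑[ i < m ] ∑[ j < n ] h i j) ≈ (∑[ j < n ] ∑[ i < m ] h i j)
  ∑-comm h zero    n = sym (∑-zero n λ _ _ → refl)
  ∑-comm h (suc m) n = trans (+-congʳ (∑-comm h m n)) (sym (∑-distrib-+ _ _ n))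

  ∑-extend : ∀ g {m n} → m ≤ n → (∀ j → m ≤ j → j < n → g j ≈ 0#) → sumBelow m g ≈ sumBelow n g
  ∑-extend g {n = zero}  z≤n _ = refl
  ∑-extend g {m} {suc n} m≤1+n tail with ℕ.m≤n⇒m<n∨m≡n m≤1+n
  ... | inj₂ ≡.refl = refl
  ... | inj₁ m<1+n  =
    trans (sym (+-identityʳ _))
          (+-cong (∑-extend g (ℕ.≤-pred m<1+n) λ j m≤j j<n → tail j m≤j (ℕ.m<n⇒m<1+n j<n))
                  (sym (tail n (ℕ.≤-pred m<1+n) ℕ.≤-refl)))

  ∑-splitFirst : ∀ g n → sumBelow (suc n) g ≈ g 0 + (∑[ j < n ] g (suc j))
  ∑-splitFirst g zero    = trans (+-identityˡ _) (sym (+-identityʳ _))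
  ∑-splitFirst g (suc n) = trans (+-congʳ (∑-splitFirst g n)) (+-assoc _ _ _)

  ∑-reverse : ∀ g n → sumBelow (suc n) g ≈ (∑[ j < suc n ] g (n ∸ j))
  ∑-reverse g zero    = refl
  ∑-reverse g (suc n) = begin
    sumBelow (suc (suc n)) g                        ≈⟨ ∑-splitFirst g (suc n) ⟩
    g 0 + (∑[ i < suc n ] g (suc i))                ≈⟨ +-congˡ (∑-reverse (g ∘ suc) n) ⟩
    g 0 + (∑[ j < suc n ] g (suc (n ∸ j)))          ≈⟨ +-comm _ _ ⟩
    (∑[ j < suc n ] g (suc (n ∸ j))) + g 0
      ≈⟨ +-cong (∑-cong (suc n) λ j j≤n → reflexive (≡.cong g (≡.sym (ℕ.+-∸-assoc 1 (ℕ.≤-pred j≤n)))))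
                (reflexive (≡.cong g (≡.sym (ℕ.n∸n≡0 (suc n))))) ⟩
    (∑[ j < suc (suc n) ] g (suc n ∸ j))            ∎
    where open import Relation.Binary.Reasoning.Setoid setoid

  sumTo≈∑ : ∀ g n → sumTo R g n ≈ sumBelow (suc n) g
  sumTo≈∑ g zero    = sym (+-identityˡ _)
  sumTo≈∑ g (suc n) = +-congʳ (sumTo≈∑ g n)

  δ : ℕ → ℕ → Carrier → Carrier
  δ m n x with m ≟ n
  ... | yes _ = x
  ... | no  _ = 0#

  δ-≡ : ∀ m n x → m ≡ n → δ m n x ≈ x
  δ-≡ m n x m≡n with m ≟ n
  ... | yes _   = refl
  ... | no  m≢n = ⊥-elim (m≢n m≡n)

  δ-≢ : ∀ m n x → m ≢ n → δ m n x ≈ 0#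
  δ-≢ m n x m≢n with m ≟ n
  ... | yes m≡n = ⊥-elim (m≢n m≡n)
  ... | no  _   = refl

  δ-cong : ∀ {m m′ n x y} → m ≡ m′ → x ≈ y → δ m n x ≈ δ m′ n y
  δ-cong {m} {n = n} ≡.refl x≈y with m ≟ n
  ... | yes _ = x≈y
  ... | no  _ = refl

  δ-congʳ : ∀ m n {x y} → x ≈ y → δ m n x ≈ δ m n y
  δ-congʳ m n = δ-cong {m} {n = n} ≡.refl

  δ-zero : ∀ m n → δ m n 0# ≈ 0#
  δ-zero m n with m ≟ n
  ... | yes _ = refl
  ... | no  _ = refl

  δ-*ʳ : ∀ m n x y → δ m n x * y ≈ δ m n (x * y)
  δ-*ʳ m n x y with m ≟ n
  ... | yes _ = refl
  ... | no  _ = zeroˡ y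

  δ-∑ : ∀ m n g N → δ m n (sumBelow N g) ≈ (∑[ j < N ] δ m n (g j))
  δ-∑ m n g N with m ≟ n
  ... | yes _ = refl
  ... | no  _ = sym (∑-zero N λ _ _ → refl)

  δ-select : ∀ {m N} → m < N → ∀ x → (∑[ j < N ] δ m j x) ≈ x
  δ-select {m} {N} m<N x =
    trans (∑-single _ N m m<N λ j _ j≢m → δ-≢ m j x (j≢m ∘ ≡.sym)) (δ-≡ m m x ≡.refl)

module PowerSeries {c ℓ} (R : CommutativeRing c ℓ) where

  open CommutativeRing R hiding (zero)
  open FiniteSums R public
  open import Relation.Binary.Reasoning.Setoid setoid

  Series : Set c
  Series = ℕ → Carrier

  infix 4 _≋_
  _≋_ : Series → Series → Set ℓ
  u ≋ v = ∀ n → u n ≈ v n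

  infixl 6 _⊕_
  _⊕_ : Series → Series → Series
  (u ⊕ v) n = u n + v n

  ⊝_ : Series → Series
  (⊝ u) n = - u n

  𝟘 𝟙 : Series
  𝟘 _       = 0#
  𝟙 zero    = 1#
  𝟙 (suc _) = 0#

  infixl 7 _⊛_
  _⊛_ : Series → Series → Series
  _⊛_ = _⋆_ R

  ⊛-coeff : ∀ u v n → (u ⊛ v) n ≈ (∑[ j < suc n ] (u j * v (n ∸ j)))
  ⊛-coeff u v n = sumTo≈∑ _ n

  ⊛-cong : ∀ {u u′ v v′} → u ≋ u′ → v ≋ v′ → u ⊛ v ≋ u′ ⊛ v′
  ⊛-cong {u} {u′} {v} {v′} u≋u′ v≋v′ n =
    trans (⊛-coeff u v n) (trans (∑-cong′ (suc n) λ j → *-cong (u≋u′ j) (v≋v′ (n ∸ j))) (sym (⊛-coeff u′ v′ n)))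

  ⊛-as-double-sum : ∀ u v {n N} → n < N →
    (u ⊛ v) n ≈ (∑[ i < N ] ∑[ j < N ] δ (i ℕ.+ j) n (u i * v j))
  ⊛-as-double-sum u v {n} {N} n<N = begin
    (u ⊛ v) n                                           ≈⟨ ⊛-coeff u v n ⟩
    (∑[ i < suc n ] (u i * v (n ∸ i)))                  ≈⟨ ∑-cong (suc n) (λ i i≤n → sym (inner (ℕ.≤-pred i≤n))) ⟩
    (∑[ i < suc n ] ∑[ j < N ] δ (i ℕ.+ j) n (u i * v j)) ≈⟨ ∑-extend _ n<N (λ i n<i _ → ∑-zero N λ j _ →
                                                                δ-≢ (i ℕ.+ j) n _ (too-big n<i)) ⟩
    (∑[ i < N ] ∑[ j < N ] δ (i ℕ.+ j) n (u i * v j))   ∎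
    where
    too-big : ∀ {i j} → n < i → i ℕ.+ j ≢ n
    too-big {i} {j} n<i i+j≡n = ℕ.<⇒≱ n<i (≡.subst (i ≤_) i+j≡n (ℕ.m≤m+n i j))
    inner : ∀ {i} → i ≤ n → (∑[ j < N ] δ (i ℕ.+ j) n (u i * v j)) ≈ u i * v (n ∸ i)
    inner {i} i≤n =
      trans (∑-single _ N (n ∸ i) (ℕ.≤-<-trans (ℕ.m∸n≤m n i) n<N) λ j _ j≢ →
               δ-≢ (i ℕ.+ j) n _ λ i+j≡n → j≢ (≡.trans (≡.sym (ℕ.m+n∸m≡n i j)) (≡.cong (_∸ i) i+j≡n)))
            (δ-≡ (i ℕ.+ (n ∸ i)) n _ (ℕ.m+[n∸m]≡n i≤n))

  ⊛-comm : ∀ u v → u ⊛ v ≋ v ⊛ u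
  ⊛-comm u v n = begin
    (u ⊛ v) n                                          ≈⟨ ⊛-as-double-sum u v (ℕ.n<1+n n) ⟩
    (∑[ i < suc n ] ∑[ j < suc n ] δ (i ℕ.+ j) n (u i * v j)) ≈⟨ ∑-comm _ (suc n) (suc n) ⟩
    (∑[ j < suc n ] ∑[ i < suc n ] δ (i ℕ.+ j) n (u i * v j)) ≈⟨ ∑-cong′ (suc n) (λ j → ∑-cong′ (suc n) λ i →
                                                                    δ-cong (ℕ.+-comm i j) (*-comm _ _)) ⟩
    (∑[ j < suc n ] ∑[ i < suc n ] δ (j ℕ.+ i) n (v j * u i)) ≈⟨ sym (⊛-as-double-sum v u (ℕ.n<1+n n)) ⟩
    (v ⊛ u) n                                          ∎

  δ-collapse : ∀ (F : ℕ → ℕ) → (∀ a → a ≤ F a) → ∀ {n N} → n < N → ∀ m x →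
    (∑[ a < N ] δ (F a) n (δ m a x)) ≈ δ (F m) n x
  δ-collapse F a≤Fa {n} {N} n<N m x with m ℕ.<? N
  ... | yes m<N =
    trans (∑-single _ N m m<N λ a _ a≢m → trans (δ-congʳ (F a) n (δ-≢ m a x λ m≡a → a≢m (≡.sym m≡a))) (δ-zero (F a) n))
          (δ-congʳ (F m) n (δ-≡ m m x ≡.refl))
  ... | no m≮N =
    trans (∑-zero N λ a a<N → trans (δ-congʳ (F a) n (δ-≢ m a x λ { ≡.refl → m≮N a<N })) (δ-zero (F a) n))
          (sym (δ-≢ (F m) n x λ Fm≡n → m≮N (ℕ.≤-<-trans (a≤Fa m) (≡.subst (_< N) (≡.sym Fm≡n) n<N))))

  ∑⁴-reorder : ∀ (h : ℕ → ℕ → ℕ → ℕ → Carrier) N →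
    (∑[ a < N ] ∑[ b < N ] ∑[ i < N ] ∑[ j < N ] h a b i j) ≈
    (∑[ i < N ] ∑[ j < N ] ∑[ b < N ] ∑[ a < N ] h a b i j)
  ∑⁴-reorder h N = begin
    (∑[ a < N ] ∑[ b < N ] ∑[ i < N ] ∑[ j < N ] h a b i j) ≈⟨ ∑-cong′ N (λ a → ∑-comm _ N N) ⟩
    (∑[ a < N ] ∑[ i < N ] ∑[ b < N ] ∑[ j < N ] h a b i j) ≈⟨ ∑-cong′ N (λ a → ∑-cong′ N λ i → ∑-comm _ N N) ⟩
    (∑[ a < N ] ∑[ i < N ] ∑[ j < N ] ∑[ b < N ] h a b i j) ≈⟨ ∑-comm _ N N ⟩
    (∑[ i < N ] ∑[ a < N ] ∑[ j < N ] ∑[ b < N ] h a b i j) ≈⟨ ∑-cong′ N (λ i → ∑-comm _ N N) ⟩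
    (∑[ i < N ] ∑[ j < N ] ∑[ a < N ] ∑[ b < N ] h a b i j) ≈⟨ ∑-cong′ N (λ i → ∑-cong′ N λ j → ∑-comm _ N N) ⟩
    (∑[ i < N ] ∑[ j < N ] ∑[ b < N ] ∑[ a < N ] h a b i j) ∎

  ⊛-as-triple-sum : ∀ x y z n →
    ((x ⊛ y) ⊛ z) n ≈ (∑[ i < suc n ] ∑[ j < suc n ] ∑[ b < suc n ] δ ((i ℕ.+ j) ℕ.+ b) n ((x i * y j) * z b))
  ⊛-as-triple-sum x y z n = begin
    ((x ⊛ y) ⊛ z) n
      ≈⟨ ⊛-as-double-sum (x ⊛ y) z n<N ⟩
    (∑[ a < N ] ∑[ b < N ] δ (a ℕ.+ b) n ((x ⊛ y) a * z b))
      ≈⟨ ∑-cong N (λ a a<N → ∑-cong′ N λ b → expand a b a<N) ⟩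
    (∑[ a < N ] ∑[ b < N ] ∑[ i < N ] ∑[ j < N ] δ (a ℕ.+ b) n (δ (i ℕ.+ j) a ((x i * y j) * z b)))
      ≈⟨ ∑⁴-reorder _ N ⟩
    (∑[ i < N ] ∑[ j < N ] ∑[ b < N ] ∑[ a < N ] δ (a ℕ.+ b) n (δ (i ℕ.+ j) a ((x i * y j) * z b)))
      ≈⟨ ∑-cong′ N (λ i → ∑-cong′ N λ j → ∑-cong′ N λ b →
           δ-collapse (ℕ._+ b) (λ a → ℕ.m≤m+n a b) n<N (i ℕ.+ j) ((x i * y j) * z b)) ⟩
    (∑[ i < N ] ∑[ j < N ] ∑[ b < N ] δ ((i ℕ.+ j) ℕ.+ b) n ((x i * y j) * z b)) ∎
    where
    N : ℕ
    N = suc n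
    n<N : n < N
    n<N = ℕ.n<1+n n
    expand : ∀ a b → a < N → δ (a ℕ.+ b) n ((x ⊛ y) a * z b) ≈
             (∑[ i < N ] ∑[ j < N ] δ (a ℕ.+ b) n (δ (i ℕ.+ j) a ((x i * y j) * z b)))
    expand a b a<N = begin
      δ (a ℕ.+ b) n ((x ⊛ y) a * z b)
        ≈⟨ δ-congʳ (a ℕ.+ b) n (*-congʳ (⊛-as-double-sum x y a<N)) ⟩
      δ (a ℕ.+ b) n ((∑[ i < N ] ∑[ j < N ] δ (i ℕ.+ j) a (x i * y j)) * z b)
        ≈⟨ δ-congʳ (a ℕ.+ b) n (trans (*-distribʳ-∑ _ _ N) (∑-cong′ N λ i → trans (*-distribʳ-∑ _ _ N)
             (∑-cong′ N λ j → δ-*ʳ (i ℕ.+ j) a (x i * y j) (z b)))) ⟩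
      δ (a ℕ.+ b) n (∑[ i < N ] ∑[ j < N ] δ (i ℕ.+ j) a ((x i * y j) * z b))
        ≈⟨ trans (δ-∑ (a ℕ.+ b) n _ N) (∑-cong′ N λ i → δ-∑ (a ℕ.+ b) n _ N) ⟩
      (∑[ i < N ] ∑[ j < N ] δ (a ℕ.+ b) n (δ (i ℕ.+ j) a ((x i * y j) * z b))) ∎

  -- Both bracketings are ∑_{i + j + b = n} uᵢ vⱼ w_b; commutativity turns the right one into a left one.
  ⊛-assoc : ∀ u v w → (u ⊛ v) ⊛ w ≋ u ⊛ (v ⊛ w)
  ⊛-assoc u v w n = begin
    ((u ⊛ v) ⊛ w) n
      ≈⟨ ⊛-as-triple-sum u v w n ⟩
    (∑[ i < N ] ∑[ j < N ] ∑[ b < N ] δ ((i ℕ.+ j) ℕ.+ b) n ((u i * v j) * w b))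
      ≈⟨ ∑-cong′ N (λ i → ∑-cong′ N λ j → ∑-cong′ N λ b → δ-cong (rotate i j b) (rotate* (u i) (v j) (w b))) ⟩
    (∑[ i < N ] ∑[ j < N ] ∑[ b < N ] δ ((j ℕ.+ b) ℕ.+ i) n ((v j * w b) * u i))
      ≈⟨ trans (∑-cong′ N (λ j → ∑-comm _ N N)) (∑-comm _ N N) ⟨
    (∑[ j < N ] ∑[ b < N ] ∑[ i < N ] δ ((j ℕ.+ b) ℕ.+ i) n ((v j * w b) * u i))
      ≈⟨ ⊛-as-triple-sum v w u n ⟨
    ((v ⊛ w) ⊛ u) n
      ≈⟨ ⊛-comm (v ⊛ w) u n ⟩
    (u ⊛ (v ⊛ w)) n ∎
    where
    N : ℕ
    N = suc n
    rotate : ∀ i j b → (i ℕ.+ j) ℕ.+ b ≡ (j ℕ.+ b) ℕ.+ i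
    rotate i j b = ≡.trans (ℕ.+-assoc i j b) (ℕ.+-comm i (j ℕ.+ b))
    rotate* : ∀ x y z → (x * y) * z ≈ (y * z) * x
    rotate* x y z = trans (*-assoc x y z) (*-comm x (y * z))

  ⊛-identityˡ : ∀ v → 𝟙 ⊛ v ≋ v
  ⊛-identityˡ v n =
    trans (⊛-coeff 𝟙 v n) (trans (∑-single _ (suc n) 0 (s≤s z≤n) others) (*-identityˡ (v n)))
    where
    others : ∀ j → j < suc n → j ≢ 0 → 𝟙 j * v (n ∸ j) ≈ 0#
    others zero    _ 0≢0 = ⊥-elim (0≢0 ≡.refl)
    others (suc j) _ _   = zeroˡ _

  ⊛-distribʳ : ∀ u v w → (v ⊕ w) ⊛ u ≋ v ⊛ u ⊕ w ⊛ u
  ⊛-distribʳ u v w n =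
    trans (⊛-coeff _ u n) (trans (∑-cong′ (suc n) λ j → distribʳ _ _ _)
      (trans (∑-distrib-+ _ _ (suc n)) (sym (+-cong (⊛-coeff v u n) (⊛-coeff w u n)))))

  ⊛-isCommutativeRing : IsCommutativeRing _≋_ _⊕_ _⊛_ ⊝_ 𝟘 𝟙
  ⊛-isCommutativeRing = record
    { isRing = record
      { +-isAbelianGroup = Pointwise.isAbelianGroup ℕ +-isAbelianGroup
      ; *-cong = ⊛-cong
      ; *-assoc = ⊛-assoc
      ; *-identity = ⊛-identityˡ , λ v n → trans (⊛-comm v 𝟙 n) (⊛-identityˡ v n)
      ; distrib = (λ u v w n → trans (⊛-comm u (v ⊕ w) n)
                                  (trans (⊛-distribʳ u v w n) (+-cong (⊛-comm v u n) (⊛-comm w u n))))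
                , ⊛-distribʳ
      }
    ; *-comm = ⊛-comm
    }

  powerSeriesRing : CommutativeRing c ℓ
  powerSeriesRing = record { isCommutativeRing = ⊛-isCommutativeRing }

  open import Algebra.Properties.Semiring.Exp semiring using (_^_)
  open import Algebra.Properties.Semiring.Exp (CommutativeRing.semiring powerSeriesRing) public
    using () renaming (_^_ to _⊛^_)

  const : Carrier → Series
  const x zero    = x
  const x (suc _) = 0#

  monomial : Carrier → ℕ → Series
  monomial x d n = δ n d x

  ⊛-monomial-≤ : ∀ u x {d n} → d ≤ n → (u ⊛ monomial x d) n ≈ u (n ∸ d) * x
  ⊛-monomial-≤ u x {d} {n} d≤n =
    trans (⊛-coeff u (monomial x d) n) (trans (∑-single _ (suc n) (n ∸ d) (s≤s (ℕ.m∸n≤m n d)) others)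
      (*-congˡ (δ-≡ (n ∸ (n ∸ d)) d x (ℕ.m∸[m∸n]≡n d≤n))))
    where
    others : ∀ j → j < suc n → j ≢ n ∸ d → u j * monomial x d (n ∸ j) ≈ 0#
    others j j≤n j≢ = trans (*-congˡ (δ-≢ (n ∸ j) d x λ n∸j≡d →
      j≢ (≡.trans (≡.sym (ℕ.m∸[m∸n]≡n (ℕ.≤-pred j≤n))) (≡.cong (n ∸_) n∸j≡d)))) (zeroʳ _)

  ⊛-monomial-> : ∀ u x {d n} → n < d → (u ⊛ monomial x d) n ≈ 0#
  ⊛-monomial-> u x {d} {n} n<d = trans (⊛-coeff u (monomial x d) n) (∑-zero (suc n) λ j _ →
    trans (*-congˡ (δ-≢ (n ∸ j) d x λ n∸j≡d → ℕ.<⇒≢ (ℕ.≤-<-trans (ℕ.m∸n≤m n j) n<d) n∸j≡d)) (zeroʳ _))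

  monomial-⊛-monomial : ∀ x y i j → monomial x i ⊛ monomial y j ≋ monomial (x * y) (i ℕ.+ j)
  monomial-⊛-monomial x y i j n with j ℕ.≤? n
  ... | yes j≤n = trans (⊛-monomial-≤ (monomial x i) y j≤n)
    (trans (δ-*ʳ (n ∸ j) i x y) (same-test (δ-≡ (n ∸ j) i _) (δ-≢ (n ∸ j) i _)
                                            (δ-≡ n (i ℕ.+ j) _) (δ-≢ n (i ℕ.+ j) _)))
    where
    to : n ∸ j ≡ i → n ≡ i ℕ.+ j
    to n∸j≡i = ≡.trans (≡.sym (ℕ.m∸n+n≡m j≤n)) (≡.cong (ℕ._+ j) n∸j≡i)
    same-test : ∀ {a b} → (n ∸ j ≡ i → a ≈ x * y) → (n ∸ j ≢ i → a ≈ 0#) →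
                (n ≡ i ℕ.+ j → b ≈ x * y) → (n ≢ i ℕ.+ j → b ≈ 0#) → a ≈ b
    same-test a-yes a-no b-yes b-no with n ∸ j ≟ i
    ... | yes n∸j≡i = trans (a-yes n∸j≡i) (sym (b-yes (to n∸j≡i)))
    ... | no  n∸j≢i = trans (a-no n∸j≢i) (sym (b-no λ n≡i+j →
                        n∸j≢i (≡.trans (≡.cong (_∸ j) n≡i+j) (ℕ.m+n∸n≡m i j))))
  ... | no j≰n = trans (⊛-monomial-> (monomial x i) y (ℕ.≰⇒> j≰n))
    (sym (δ-≢ n (i ℕ.+ j) _ λ n≡i+j → j≰n (≡.subst (j ≤_) (≡.sym n≡i+j) (ℕ.m≤n+m j i))))

  𝟙≋monomial : 𝟙 ≋ monomial 1# 0
  𝟙≋monomial zero    = sym (δ-≡ 0 0 1# ≡.refl)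
  𝟙≋monomial (suc n) = sym (δ-≢ (suc n) 0 1# λ ())

  monomial-^ : ∀ x d k → monomial x d ⊛^ k ≋ monomial (x ^ k) (k ℕ.* d)
  monomial-^ x d zero    = 𝟙≋monomial
  monomial-^ x d (suc k) n =
    trans (⊛-cong (λ _ → refl) (monomial-^ x d k) n) (monomial-⊛-monomial x (x ^ k) d (k ℕ.* d) n)

  ⊛-coeff-local : ∀ {u u′ v v′} n → (∀ i → i ≤ n → u i ≈ u′ i) → (∀ i → i ≤ n → v i ≈ v′ i) →
                  (u ⊛ v) n ≈ (u′ ⊛ v′) n
  ⊛-coeff-local {u} {u′} {v} {v′} n u≈u′ v≈v′ =
    trans (⊛-coeff u v n) (trans (∑-cong (suc n) (λ j j≤n →
      *-cong (u≈u′ j (ℕ.≤-pred j≤n)) (v≈v′ (n ∸ j) (ℕ.m∸n≤m n j)))) (sym (⊛-coeff u′ v′ n)))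

  ^-coeff-local : ∀ {u u′} k n → (∀ i → i ≤ n → u i ≈ u′ i) → (u ⊛^ k) n ≈ (u′ ⊛^ k) n
  ^-coeff-local zero    n _    = refl
  ^-coeff-local (suc k) n u≈u′ =
    ⊛-coeff-local n u≈u′ λ i i≤n → ^-coeff-local k i λ i′ i′≤i → u≈u′ i′ (ℕ.≤-trans i′≤i i≤n)

  SupportedIn : Pred ℕ 0ℓ → Series → Set ℓ
  SupportedIn P u = ∀ n → ¬ P n → u n ≈ 0#

  module _ {P Q S : Pred ℕ 0ℓ} where

    ⊛-supportedIn : ∀ {u v} → Decidable P → Decidable Q → SupportedIn P u → SupportedIn Q v →
                    (∀ {i j} → P i → Q j → S (i ℕ.+ j)) → SupportedIn S (u ⊛ v)
    ⊛-supportedIn {u} {v} P? Q? u∈P v∈Q closed n ¬Sn =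
      trans (⊛-coeff u v n) (∑-zero (suc n) term)
      where
      term : ∀ j → j < suc n → u j * v (n ∸ j) ≈ 0#
      term j j≤n with P? j | Q? (n ∸ j)
      ... | no ¬Pj | _      = trans (*-congʳ (u∈P j ¬Pj)) (zeroˡ _)
      ... | yes _  | no ¬Q  = trans (*-congˡ (v∈Q _ ¬Q)) (zeroʳ _)
      ... | yes Pj | yes Qk = ⊥-elim (¬Sn (≡.subst S (ℕ.m+[n∸m]≡n (ℕ.≤-pred j≤n)) (closed Pj Qk)))

  ⊕-supportedIn : ∀ {P u v} → SupportedIn P u → SupportedIn P v → SupportedIn P (u ⊕ v)
  ⊕-supportedIn u∈P v∈P n ¬Pn = trans (+-cong (u∈P n ¬Pn) (v∈P n ¬Pn)) (+-identityˡ 0#)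

  supportedIn-resp-≋ : ∀ {P u v} → u ≋ v → SupportedIn P u → SupportedIn P v
  supportedIn-resp-≋ u≋v u∈P n ¬Pn = trans (sym (u≋v n)) (u∈P n ¬Pn)

  supportedIn-weaken : ∀ {P P′ u} → P ⊆ P′ → SupportedIn P u → SupportedIn P′ u
  supportedIn-weaken P⊆P′ u∈P n ¬P′n = u∈P n λ Pn → ¬P′n (P⊆P′ Pn)

  ⊛-single-term : ∀ u v n i → i ≤ n → (∀ j → j ≤ n → j ≢ i → u j * v (n ∸ j) ≈ 0#) →
                  (u ⊛ v) n ≈ u i * v (n ∸ i)
  ⊛-single-term u v n i i≤n others =
    trans (⊛-coeff u v n) (∑-single _ (suc n) i (s≤s i≤n) λ j j≤n → others j (ℕ.≤-pred j≤n))

  ⊛-lowest : ∀ {u v a b} → SupportedIn (a ≤_) u → SupportedIn (b ≤_) v →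
             (u ⊛ v) (a ℕ.+ b) ≈ u a * v b
  ⊛-lowest {u} {v} {a} {b} u≥a v≥b =
    trans (⊛-single-term u v (a ℕ.+ b) a (ℕ.m≤m+n a b) others) (*-congˡ (reflexive (≡.cong v (ℕ.m+n∸m≡n a b))))
    where
    others : ∀ j → j ≤ a ℕ.+ b → j ≢ a → u j * v (a ℕ.+ b ∸ j) ≈ 0#
    others j j≤a+b j≢a with j ℕ.<? a
    ... | yes j<a = trans (*-congʳ (u≥a j (ℕ.<⇒≱ j<a))) (zeroˡ _)
    ... | no  j≮a = trans (*-congˡ (v≥b _ (ℕ.<⇒≱ (≡.subst (a ℕ.+ b ∸ j <_) (ℕ.m+n∸m≡n a b)
                      (ℕ.∸-monoʳ-< (ℕ.≤∧≢⇒< (ℕ.≮⇒≥ j≮a) (j≢a ∘ ≡.sym)) j≤a+b))))) (zeroʳ _)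

  Degree≤ : ℕ → Series → Set ℓ
  Degree≤ d = SupportedIn (_≤ d)

  ⊛-degree : ∀ {u v d₁ d₂} → Degree≤ d₁ u → Degree≤ d₂ v → Degree≤ (d₁ ℕ.+ d₂) (u ⊛ v)
  ⊛-degree {d₁ = d₁} {d₂} u≤d₁ v≤d₂ = ⊛-supportedIn (ℕ._≤? d₁) (ℕ._≤? d₂) u≤d₁ v≤d₂ ℕ.+-mono-≤

  ⊛-top : ∀ {u v d₁ d₂} → Degree≤ d₁ u → Degree≤ d₂ v → (u ⊛ v) (d₁ ℕ.+ d₂) ≈ u d₁ * v d₂
  ⊛-top {u} {v} {d₁} {d₂} u≤d₁ v≤d₂ =
    trans (⊛-single-term u v (d₁ ℕ.+ d₂) d₁ (ℕ.m≤m+n d₁ d₂) others) (*-congˡ (reflexive (≡.cong v (ℕ.m+n∸m≡n d₁ d₂))))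
    where
    others : ∀ j → j ≤ d₁ ℕ.+ d₂ → j ≢ d₁ → u j * v (d₁ ℕ.+ d₂ ∸ j) ≈ 0#
    others j _ j≢d₁ with j ℕ.<? d₁
    ... | no  j≮d₁ = trans (*-congʳ (u≤d₁ j λ j≤d₁ → j≮d₁ (ℕ.≤∧≢⇒< j≤d₁ j≢d₁))) (zeroˡ _)
    ... | yes j<d₁ = trans (*-congˡ (v≤d₂ _ (ℕ.<⇒≱ (≡.subst (_< d₁ ℕ.+ d₂ ∸ j) (ℕ.m+n∸m≡n d₁ d₂)
                       (ℕ.∸-monoʳ-< j<d₁ (ℕ.m≤m+n d₁ d₂)))))) (zeroʳ _)

  𝟙-degree : Degree≤ 0 𝟙
  𝟙-degree zero    0≰0 = ⊥-elim (0≰0 z≤n)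
  𝟙-degree (suc n) _   = refl

  ^-degree : ∀ {u} N → Degree≤ 1 u → Degree≤ N (u ⊛^ N)
  ^-degree zero    _   = 𝟙-degree
  ^-degree (suc N) u≤1 = ⊛-degree u≤1 (^-degree N u≤1)

  ^-top : ∀ {u} N → Degree≤ 1 u → (u ⊛^ N) N ≈ u 1 ^ N
  ^-top zero    _   = refl
  ^-top (suc N) u≤1 = trans (⊛-top u≤1 (^-degree N u≤1)) (*-congˡ (^-top N u≤1))

  ∏-degree : ∀ s (u : Fin s → Series) (d : Fin s → ℕ) → (∀ i → Degree≤ (d i) (u i)) →
             Degree≤ (sumFinℕ s d) (prodFin powerSeriesRing s u)
  ∏-degree zero    u d _      = 𝟙-degree
  ∏-degree (suc s) u d u≤d = ⊛-degree (u≤d Fin.zero) (∏-degree s (u ∘ Fin.suc) (d ∘ Fin.suc) (u≤d ∘ Fin.suc))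

  ∏-top : ∀ s (u : Fin s → Series) (d : Fin s → ℕ) → (∀ i → Degree≤ (d i) (u i)) →
          prodFin powerSeriesRing s u (sumFinℕ s d) ≈ prodFin R s (λ i → u i (d i))
  ∏-top zero    u d _      = refl
  ∏-top (suc s) u d u≤d =
    trans (⊛-top (u≤d Fin.zero) (∏-degree s (u ∘ Fin.suc) (d ∘ Fin.suc) (u≤d ∘ Fin.suc)))
          (*-congˡ (∏-top s (u ∘ Fin.suc) (d ∘ Fin.suc) (u≤d ∘ Fin.suc)))

  module _ {u : Series} (u₀≈0 : u 0 ≈ 0#) where

    private
      u≥1 : SupportedIn (1 ≤_) u
      u≥1 zero    1≰0 = u₀≈0
      u≥1 (suc n) 1≰  = ⊥-elim (1≰ (s≤s z≤n))

    ^-supported-≥ : ∀ Y → SupportedIn (Y ≤_) (u ⊛^ Y)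
    ^-supported-≥ zero    n 0≰n = ⊥-elim (0≰n z≤n)
    ^-supported-≥ (suc Y) = ⊛-supportedIn (1 ℕ.≤?_) (Y ℕ.≤?_) u≥1 (^-supported-≥ Y) ℕ.+-mono-≤

    ^-vanishes-below : ∀ Y n → n < Y → (u ⊛^ Y) n ≈ 0#
    ^-vanishes-below Y n n<Y = ^-supported-≥ Y n (ℕ.<⇒≱ n<Y)

    ^-lowest : ∀ Y → (u ⊛^ Y) Y ≈ u 1 ^ Y
    ^-lowest zero    = refl
    ^-lowest (suc Y) = trans (⊛-lowest u≥1 (^-supported-≥ Y)) (*-congˡ (^-lowest Y))

  module _ (a F : Series) (F₀≈0 : F 0 ≈ 0#) where

    ⊛-oneMinus : ∀ n → (a ⊛ oneMinus R F) n ≈ a n - (∑[ j < n ] (a j * F (n ∸ j)))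
    ⊛-oneMinus n = begin
      (a ⊛ oneMinus R F) n
        ≈⟨ ⊛-coeff a (oneMinus R F) n ⟩
      (∑[ j < n ] (a j * oneMinus R F (n ∸ j))) + a n * oneMinus R F (n ∸ n)
        ≈⟨ +-cong (∑-cong n λ j j<n → *-congˡ (oneMinus-pos (ℕ.m<n⇒0<n∸m j<n))) (*-congˡ oneMinus-0) ⟩
      (∑[ j < n ] (a j * - F (n ∸ j))) + a n * 1#
        ≈⟨ +-cong (trans (∑-cong′ n λ j → sym (-‿distribʳ-* _ _)) (∑-neg _ n)) (*-identityʳ _) ⟩
      - (∑[ j < n ] (a j * F (n ∸ j))) + a n
        ≈⟨ +-comm _ _ ⟩
      a n - (∑[ j < n ] (a j * F (n ∸ j))) ∎
      where
      open import Algebra.Properties.Ring ring using (-‿distribʳ-*; -0#≈0#)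
      oneMinus-pos : ∀ {l} → 0 < l → oneMinus R F l ≈ - F l
      oneMinus-pos {suc l} _ = refl
      oneMinus-0 : oneMinus R F (n ∸ n) ≈ 1#
      oneMinus-0 = trans (reflexive (≡.cong (oneMinus R F) (ℕ.n∸n≡0 n)))
                         (trans (+-congˡ (trans (-‿cong F₀≈0) -0#≈0#)) (+-identityʳ 1#))

    ∑-below≈⊛ : ∀ n → (∑[ j < n ] (a j * F (n ∸ j))) ≈ (a ⊛ F) n
    ∑-below≈⊛ n = trans (sym (+-identityʳ _))
      (trans (+-congˡ (sym (trans (*-congˡ (trans (reflexive (≡.cong F (ℕ.n∸n≡0 n))) F₀≈0)) (zeroʳ _))))
             (sym (⊛-coeff a F n)))

    ⊛-oneMinus⇒recurrence : ∀ {r} → a ⊛ oneMinus R F ≋ r → ∀ n → a n ≈ r n + (∑[ j < n ] (a j * F (n ∸ j)))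
    ⊛-oneMinus⇒recurrence {r} eq n = begin
      a n                   ≈⟨ sym (+-identityʳ _) ⟩
      a n + 0#              ≈⟨ +-congˡ (sym (-‿inverseˡ S)) ⟩
      a n + (- S + S)       ≈⟨ sym (+-assoc _ _ _) ⟩
      a n - S + S           ≈⟨ +-congʳ (trans (sym (⊛-oneMinus n)) (eq n)) ⟩
      r n + S               ∎
      where
      S : Carrier
      S = ∑[ j < n ] (a j * F (n ∸ j))

    recurrence⇒⊛-oneMinus : ∀ {r} → (∀ n → a n ≈ r n + (∑[ j < n ] (a j * F (n ∸ j)))) → a ⊛ oneMinus R F ≋ r
    recurrence⇒⊛-oneMinus {r} rec n = begin
      (a ⊛ oneMinus R F) n  ≈⟨ ⊛-oneMinus n ⟩
      a n - S               ≈⟨ +-congʳ (rec n) ⟩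
      r n + S - S           ≈⟨ +-assoc _ _ _ ⟩
      r n + (S - S)         ≈⟨ +-congˡ (-‿inverseʳ S) ⟩
      r n + 0#              ≈⟨ +-identityʳ _ ⟩
      r n                   ∎
      where
      S : Carrier
      S = ∑[ j < n ] (a j * F (n ∸ j))

  ⊛-scalarʳ : ∀ u x v n → (u ⊛ (λ k → x * v k)) n ≈ x * (u ⊛ v) n
  ⊛-scalarʳ u x v n = trans (⊛-coeff u (λ k → x * v k) n) (trans (∑-cong′ (suc n) λ j → x∙yz≈y∙xz (u j) x (v (n ∸ j)))
                        (trans (sym (*-distribˡ-∑ x _ (suc n))) (*-congˡ (sym (⊛-coeff u v n)))))
    where open import Algebra.Properties.CommutativeSemigroup *-commutativeSemigroup using (x∙yz≈y∙xz)

  ⊛-∑ʳ : ∀ u (x : ℕ → Carrier) (v : ℕ → Series) k n →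
         (u ⊛ (λ l → ∑[ i < k ] (x i * v i l))) n ≈ (∑[ i < k ] (x i * (u ⊛ v i) n))
  ⊛-∑ʳ u x v zero    n = trans (⊛-coeff u 𝟘 n) (∑-zero (suc n) λ _ _ → zeroʳ _)
  ⊛-∑ʳ u x v (suc k) n = trans (S.distribˡ u (λ l → ∑[ i < k ] (x i * v i l)) (λ l → x k * v k l) n)
                           (+-cong (⊛-∑ʳ u x v k n) (⊛-scalarʳ u (x k) (v k) n))
    where module S = CommutativeRing powerSeriesRing

module _ {p} (p-prime : Prime p) where

  prime≥2 : 2 ≤ p
  prime≥2 = ℕ.nonTrivial⇒n>1 p {{prime⇒nonTrivial p-prime}}

  prime∤! : ∀ j → j < p → ¬ (p ∣ j !)
  prime∤! zero    _   p∣1 = ℕ.<⇒≱ prime≥2 (∣⇒≤ p∣1)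
  prime∤! (suc j) j<p p∣ with euclidsLemma (suc j) (j !) p-prime p∣
  ... | inj₁ p∣1+j = ℕ.<⇒≱ j<p (∣⇒≤ p∣1+j)
  ... | inj₂ p∣j!  = prime∤! j (ℕ.<-trans (ℕ.n<1+n j) j<p) p∣j!

  -- p divides p! = (p C k) k! (p - k)!, but neither factorial.
  prime∣prime-choose : ∀ k → 0 < k → k < p → p ∣ p C k
  prime∣prime-choose k 0<k k<p with euclidsLemma (p C k) (k ! ℕ.* (p ∸ k) !) p-prime p∣product
    where
    instance _ = ℕ._!*_!≢0 k (p ∸ k)
    p∣product : p ∣ (p C k) ℕ.* (k ! ℕ.* (p ∸ k) !)
    p∣product = ≡.subst (p ∣_)
      (≡.sym (≡.trans (≡.cong (ℕ._* (k ! ℕ.* (p ∸ k) !)) (nCk≡n!/k![n-k]! (ℕ.<⇒≤ k<p))) (m/n*n≡m (k![n∸k]!∣n! (ℕ.<⇒≤ k<p)))))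
      (p∣p! p (ℕ.<⇒≤ prime≥2))
      where
      p∣p! : ∀ n → 1 ≤ n → n ∣ n !
      p∣p! (suc n) _ = m∣m*n (n !)
  ... | inj₁ p∣pCk = p∣pCk
  ... | inj₂ p∣k![p-k]! with euclidsLemma (k !) ((p ∸ k) !) p-prime p∣k![p-k]!
  ...   | inj₁ p∣k!     = ⊥-elim (prime∤! k k<p p∣k!)
  ...   | inj₂ p∣[p-k]! = ⊥-elim (prime∤! (p ∸ k) (ℕ.∸-monoʳ-< 0<k (ℕ.<⇒≤ k<p)) p∣[p-k]!)

module RingLemmas {c ℓ} (R : CommutativeRing c ℓ) where

  open CommutativeRing R hiding (zero)
  open import Algebra.Properties.Semiring.Exp semiring using (_^_; ^-congˡ)
  open import Algebra.Properties.CommutativeSemiring.Exp commutativeSemiring using (^-distrib-*)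
  open import Relation.Binary.Reasoning.Setoid setoid
  open import Algebra.Definitions.RawMonoid +-rawMonoid using (_×_)
  open import Algebra.Properties.Monoid.Sum +-monoid using (sum; sum-cong-≋)
  open import Algebra.Properties.CommutativeSemiring.Binomial commutativeSemiring using (binomialTerm; theorem)

  ι-+ : ∀ m n → ι R (m ℕ.+ n) ≈ ι R m + ι R n
  ι-+ zero    n = sym (+-identityˡ _)
  ι-+ (suc m) n = trans (+-congˡ (ι-+ m n)) (sym (+-assoc _ _ _))

  ι-* : ∀ m n → ι R (m ℕ.* n) ≈ ι R m * ι R n
  ι-* zero    n = sym (zeroˡ _)
  ι-* (suc m) n = trans (ι-+ n (m ℕ.* n)) (trans (+-cong (sym (*-identityˡ _)) (ι-* m n)) (sym (distribʳ _ _ _)))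

  ι-^ : ∀ p m → ι R (p ℕ.^ m) ≈ ι R p ^ m
  ι-^ p zero    = +-identityʳ 1#
  ι-^ p (suc m) = trans (ι-* p (p ℕ.^ m)) (*-congˡ (ι-^ p m))

  ι-multiple : ∀ {p} → ι R p ≈ 0# → ∀ {n} → p ∣ n → ι R n ≈ 0#
  ι-multiple {p} ιp≈0 (divides d ≡.refl) = trans (ι-* d p) (trans (*-congˡ ιp≈0) (zeroʳ _))

  ×≈ι* : ∀ n x → n × x ≈ ι R n * x
  ×≈ι* zero    x = sym (zeroˡ x)
  ×≈ι* (suc n) x = trans (+-cong (sym (*-identityˡ x)) (×≈ι* n x)) (sym (distribʳ _ _ _))

  pow≡^ : ∀ x n → pow R x n ≡ x ^ n
  pow≡^ x zero    = ≡.refl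
  pow≡^ x (suc n) = ≡.cong (x *_) (pow≡^ x n)

  0^n≈0 : ∀ {n} → 0 < n → 0# ^ n ≈ 0#
  0^n≈0 {suc n} _ = zeroˡ _

  1^n≈1 : ∀ n → 1# ^ n ≈ 1#
  1^n≈1 zero    = refl
  1^n≈1 (suc n) = trans (*-identityˡ _) (1^n≈1 n)

  module _ (isField : IsFieldR R) {q} (subfield : HasSubfieldOfSize R q) where
    open IsFieldR isField
    open HasSubfieldOfSize subfield
    open import Algebra.Properties.CommutativeMonoid.Sum +-commutativeMonoid using (sum-permute; ∑-distrib-+)
    open import Algebra.Properties.Ring ring using (+-identityʳ-unique)

    private
      _+ᵢ_ : Fin q → Fin q → Fin q
      i +ᵢ j = proj₁ (clos-+ i j)

      emb-+ : ∀ i j → emb (i +ᵢ j) ≈ emb i + emb j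
      emb-+ i j = sym (proj₂ (clos-+ i j))

      1ᵢ -1ᵢ : Fin q
      1ᵢ  = proj₁ has-1
      -1ᵢ = proj₁ (clos-neg 1ᵢ)

      emb-1 : emb 1ᵢ ≈ 1#
      emb-1 = proj₂ has-1

      emb--1 : emb -1ᵢ ≈ - 1#
      emb--1 = trans (sym (proj₂ (clos-neg 1ᵢ))) (-‿cong emb-1)

      cancelling-shift : ∀ a b → emb a + emb b ≈ 0# → ∀ i → (i +ᵢ a) +ᵢ b ≡ i
      cancelling-shift a b a+b≈0 i = emb-inj _ _ (begin
        emb ((i +ᵢ a) +ᵢ b)    ≈⟨ trans (emb-+ _ b) (+-congʳ (emb-+ i a)) ⟩
        emb i + emb a + emb b  ≈⟨ +-assoc _ _ _ ⟩
        emb i + (emb a + emb b) ≈⟨ +-congˡ a+b≈0 ⟩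
        emb i + 0#             ≈⟨ +-identityʳ _ ⟩
        emb i                  ∎)

      translation : Permutation q q
      translation = permutation (_+ᵢ 1ᵢ) (_+ᵢ -1ᵢ)
        (cancelling-shift -1ᵢ 1ᵢ (trans (+-cong emb--1 emb-1) (-‿inverseˡ 1#)))
        (cancelling-shift 1ᵢ -1ᵢ (trans (+-cong emb-1 emb--1) (-‿inverseʳ 1#)))

      sum-1 : ∀ n → sum {n} (λ _ → 1#) ≈ ι R n
      sum-1 zero    = refl
      sum-1 (suc n) = +-congˡ (sum-1 n)

      index-of-ι : ∀ n → ∃ λ i → ι R n ≈ emb i
      index-of-ι zero    = proj₁ has-0 , sym (proj₂ has-0)
      index-of-ι (suc n) with index-of-ι n
      ... | i , ιn≈i = 1ᵢ +ᵢ i , trans (+-cong (sym emb-1) ιn≈i) (sym (emb-+ 1ᵢ i))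

    -- Translation by 1 permutes the subfield, so ∑ x = ∑ (x + 1) = ∑ x + q · 1.
    ι-size≈0 : ι R q ≈ 0#
    ι-size≈0 = +-identityʳ-unique (sum emb) (ι R q) (sym (begin
      sum emb                       ≈⟨ sum-permute emb translation ⟩
      sum (λ i → emb (i +ᵢ 1ᵢ))     ≈⟨ sum-cong-≋ (λ i → trans (emb-+ i 1ᵢ) (+-congˡ emb-1)) ⟩
      sum (λ i → emb i + 1#)        ≈⟨ ∑-distrib-+ emb (λ _ → 1#) ⟩
      sum emb + sum {q} (λ _ → 1#)  ≈⟨ +-congˡ (sum-1 q) ⟩
      sum emb + ι R q               ∎))

    -- p · 1 lies in the subfield; were it nonzero it would be a unit, and so would q · 1 = (p · 1) ^ m.
    characteristic : ∀ p m → q ≡ p ℕ.^ m → ι R p ≈ 0#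
    characteristic p m ≡.refl with index-of-ι p
    ... | i , ιp≈i with i Fin.≟ proj₁ has-0
    ...   | yes ≡.refl = trans ιp≈i (proj₂ has-0)
    ...   | no  i≢0    = ⊥-elim (0≉1 (begin
      0#                   ≈⟨ sym (zeroˡ _) ⟩
      0# * y ^ m           ≈⟨ *-congʳ (trans (sym ι-size≈0) (ι-^ p m)) ⟩
      ι R p ^ m * y ^ m    ≈⟨ sym (^-distrib-* _ _ m) ⟩
      (ι R p * y) ^ m      ≈⟨ ^-congˡ m ιp*y≈1 ⟩
      1# ^ m               ≈⟨ 1^n≈1 m ⟩
      1#                   ∎))
      where
      ιp≉0 : ¬ (ι R p ≈ 0#)
      ιp≉0 ιp≈0 = i≢0 (emb-inj _ _ (trans (sym ιp≈i) (trans ιp≈0 (sym (proj₂ has-0)))))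
      y : Carrier
      y = proj₁ (inverse (ι R p) ιp≉0)
      ιp*y≈1 : ι R p * y ≈ 1#
      ιp*y≈1 = proj₂ (inverse (ι R p) ιp≉0)

  private
    sum-last : ∀ n (g : Fin (suc n) → Carrier) → (∀ k → toℕ k < n → g k ≈ 0#) → sum g ≈ g (fromℕ n)
    sum-last zero    g _     = +-identityʳ _
    sum-last (suc n) g lower =
      trans (+-cong (lower Fin.zero (s≤s z≤n)) (sum-last n (g ∘ Fin.suc) λ k k<n → lower (Fin.suc k) (s≤s k<n)))
            (+-identityˡ _)

    last-term : ∀ x y n j → j ≡ n → (n C j) × (x ^ j * y ^ (n ∸ j)) ≈ x ^ n
    last-term x y n j ≡.refl = begin
      (n C n) × (x ^ n * y ^ (n ∸ n))     ≈⟨ ×≈ι* (n C n) _ ⟩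
      ι R (n C n) * (x ^ n * y ^ (n ∸ n)) ≈⟨ *-cong (reflexive (≡.cong (ι R) (nCn≡1 n)))
                                                     (*-congˡ (reflexive (≡.cong (y ^_) (ℕ.n∸n≡0 n)))) ⟩
      (1# + 0#) * (x ^ n * 1#)            ≈⟨ trans (*-cong (+-identityʳ _) (*-identityʳ _)) (*-identityˡ _) ⟩
      x ^ n                               ∎

  binomial-extremes : ∀ n → 0 < n → (∀ k → 0 < k → k < n → ι R (n C k) ≈ 0#) →
                      ∀ x y → (x + y) ^ n ≈ x ^ n + y ^ n
  binomial-extremes (suc n) _ middle≈0 x y = trans (theorem (suc n) x y) (trans (+-cong first rest) (+-comm _ _))
    where
    first : binomialTerm x y (suc n) Fin.zero ≈ y ^ suc n
    first = trans (+-identityʳ _) (*-identityˡ _)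
    rest : sum (binomialTerm x y (suc n) ∘ Fin.suc) ≈ x ^ suc n
    rest = trans (sum-last n (binomialTerm x y (suc n) ∘ Fin.suc) λ k k<n →
                   trans (×≈ι* (suc n C suc (toℕ k)) _) (trans (*-congʳ (middle≈0 (suc (toℕ k)) (s≤s z≤n) (s≤s k<n))) (zeroˡ _)))
                 (last-term x y (suc n) _ (≡.cong suc (Fin.toℕ-fromℕ n)))

  frobenius-+ : ∀ {p} → Prime p → ι R p ≈ 0# → ∀ x y → (x + y) ^ p ≈ x ^ p + y ^ p
  frobenius-+ p-prime ιp≈0 = binomial-extremes _ (ℕ.<-trans (s≤s z≤n) (prime≥2 p-prime))
    λ k 0<k k<p → ι-multiple ιp≈0 (prime∣prime-choose p-prime k 0<k k<p)

module FiniteProducts {c ℓ} (R : CommutativeRing c ℓ) where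

  open CommutativeRing R hiding (zero)
  open import Algebra.Properties.Semiring.Exp semiring using (_^_; ^-homo-*)
  open import Algebra.Properties.CommutativeSemigroup *-commutativeSemigroup using (interchange)

  ∏-cong : ∀ s {g h : Fin s → Carrier} → (∀ i → g i ≈ h i) → prodFin R s g ≈ prodFin R s h
  ∏-cong zero    _   = refl
  ∏-cong (suc s) g≈h = *-cong (g≈h Fin.zero) (∏-cong s (g≈h ∘ Fin.suc))

  ∏-distrib-* : ∀ s (g h : Fin s → Carrier) → prodFin R s (λ i → g i * h i) ≈ prodFin R s g * prodFin R s h
  ∏-distrib-* zero    g h = sym (*-identityˡ 1#)
  ∏-distrib-* (suc s) g h = trans (*-congˡ (∏-distrib-* s (g ∘ Fin.suc) (h ∘ Fin.suc))) (interchange _ _ _ _)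

  ∏-const : ∀ s x → prodFin R s (λ _ → x) ≈ x ^ s
  ∏-const zero    x = refl
  ∏-const (suc s) x = *-congˡ (∏-const s x)

  ^-sumFinℕ : ∀ x s (e : Fin s → ℕ) → x ^ sumFinℕ s e ≈ prodFin R s (λ i → x ^ e i)
  ^-sumFinℕ x zero    e = refl
  ^-sumFinℕ x (suc s) e = trans (^-homo-* x (e Fin.zero) _) (*-congˡ (^-sumFinℕ x s (e ∘ Fin.suc)))

module SeriesFrobenius {c ℓ} (R : CommutativeRing c ℓ) {p} (p-prime : Prime p) where

  open CommutativeRing R hiding (zero)
  open PowerSeries R
  open RingLemmas R using (0^n≈0; frobenius-+)
  open import Algebra.Properties.Semiring.Exp semiring using (_^_; ^-congˡ; ^-assocʳ)
  open import Relation.Binary.Reasoning.Setoid setoid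
  module S = CommutativeRing powerSeriesRing
  open import Algebra.Properties.Semiring.Exp S.semiring using () renaming (^-assocʳ to ⊛^-assocʳ)

  0<p : 0 < p
  0<p = ℕ.<-trans (s≤s z≤n) (prime≥2 p-prime)

  instance
    p≢0 : NonZero p
    p≢0 = ℕ.>-nonZero 0<p

  ι-series : ∀ n → ι powerSeriesRing n ≋ const (ι R n)
  ι-series zero    zero    = refl
  ι-series zero    (suc k) = refl
  ι-series (suc n) zero    = +-congˡ (ι-series n zero)
  ι-series (suc n) (suc k) = trans (+-congˡ (ι-series n (suc k))) (+-identityˡ _)

  module _ (ιp≈0 : ι R p ≈ 0#) where

    truncate : ℕ → Series → Series
    truncate zero    u = 𝟘
    truncate (suc N) u = truncate N u ⊕ monomial (u N) N

    truncate-coeff : ∀ N u n → n < N → truncate N u n ≈ u n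
    truncate-coeff (suc N) u n n<1+N with n ℕ.<? N
    ... | yes n<N = trans (+-cong (truncate-coeff N u n n<N) (δ-≢ n N (u N) (ℕ.<⇒≢ n<N))) (+-identityʳ _)
    ... | no  n≮N with ℕ.≤-antisym (ℕ.≤-pred n<1+N) (ℕ.≮⇒≥ n≮N)
    ...   | ≡.refl = trans (+-congʳ (above N ℕ.≤-refl)) (trans (+-identityˡ _) (δ-≡ n n (u n) ≡.refl))
      where
      above : ∀ M → M ≤ n → truncate M u n ≈ 0#
      above zero    _   = refl
      above (suc M) M<n =
        trans (+-cong (above M (ℕ.<⇒≤ M<n)) (δ-≢ n M (u M) (ℕ.>⇒≢ M<n))) (+-identityˡ 0#)

    series-characteristic : ι powerSeriesRing p ≋ 𝟘
    series-characteristic zero    = trans (ι-series p 0) ιp≈0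
    series-characteristic (suc n) = ι-series p (suc n)

    truncate-^p : ∀ N u n → (truncate N u ⊛^ p) n ≈ (∑[ j < N ] δ n (p ℕ.* j) (u j ^ p))
    truncate-^p zero    u n = RingLemmas.0^n≈0 powerSeriesRing 0<p n
    truncate-^p (suc N) u n = begin
      ((truncate N u ⊕ monomial (u N) N) ⊛^ p) n
        ≈⟨ RingLemmas.frobenius-+ powerSeriesRing p-prime series-characteristic (truncate N u) (monomial (u N) N) n ⟩
      (truncate N u ⊛^ p) n + (monomial (u N) N ⊛^ p) n
        ≈⟨ +-cong (truncate-^p N u n) (monomial-^ (u N) N p n) ⟩
      (∑[ j < N ] δ n (p ℕ.* j) (u j ^ p)) + δ n (p ℕ.* N) (u N ^ p) ∎

    ^p-as-sum : ∀ u n → (u ⊛^ p) n ≈ (∑[ j < suc n ] δ n (p ℕ.* j) (u j ^ p))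
    ^p-as-sum u n =
      trans (^-coeff-local p n λ i i≤n → sym (truncate-coeff (suc n) u i (s≤s i≤n))) (truncate-^p (suc n) u n)

    ^p-multiple : ∀ u j → (u ⊛^ p) (p ℕ.* j) ≈ u j ^ p
    ^p-multiple u j = trans (^p-as-sum u (p ℕ.* j))
      (trans (∑-single _ _ j (s≤s (ℕ.m≤n*m j p)) λ i _ i≢j →
                δ-≢ (p ℕ.* j) (p ℕ.* i) _ λ pj≡pi → i≢j (ℕ.*-cancelˡ-≡ i j p (≡.sym pj≡pi)))
             (δ-≡ (p ℕ.* j) (p ℕ.* j) _ ≡.refl))

    ^p-nonmultiple : ∀ u n → ¬ (p ∣ n) → (u ⊛^ p) n ≈ 0#
    ^p-nonmultiple u n p∤n = trans (^p-as-sum u n) (∑-zero (suc n) λ j _ →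
      δ-≢ n (p ℕ.* j) _ λ n≡pj → p∤n (divides j (≡.trans n≡pj (ℕ.*-comm p j))))

    ^p^e-multiple : ∀ e u j → (u ⊛^ (p ℕ.^ e)) (p ℕ.^ e ℕ.* j) ≈ u j ^ (p ℕ.^ e)
    ^p^e-multiple zero    u j = trans (S.*-identityʳ u (j ℕ.+ 0)) (trans (reflexive (≡.cong u (ℕ.+-identityʳ j))) (sym (*-identityʳ _)))
    ^p^e-multiple (suc e) u j = begin
      (u ⊛^ (p ℕ.* P)) (p ℕ.* P ℕ.* j)  ≈⟨ ⊛^-assocʳ u p P _ ⟨
      ((u ⊛^ p) ⊛^ P) (p ℕ.* P ℕ.* j)   ≈⟨ reflexive (≡.cong ((u ⊛^ p) ⊛^ P) (regroup p P j)) ⟩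
      ((u ⊛^ p) ⊛^ P) (P ℕ.* (p ℕ.* j)) ≈⟨ ^p^e-multiple e (u ⊛^ p) (p ℕ.* j) ⟩
      (u ⊛^ p) (p ℕ.* j) ^ P            ≈⟨ ^-congˡ P (^p-multiple u j) ⟩
      (u j ^ p) ^ P                     ≈⟨ ^-assocʳ (u j) p P ⟩
      u j ^ (p ℕ.* P)                   ∎
      where
      P : ℕ
      P = p ℕ.^ e
      regroup : ∀ a b c → a ℕ.* b ℕ.* c ≡ b ℕ.* (a ℕ.* c)
      regroup = solve-∀

    ^p^e-nonmultiple : ∀ e u n → ¬ (p ℕ.^ e ∣ n) → (u ⊛^ (p ℕ.^ e)) n ≈ 0#
    ^p^e-nonmultiple zero    u n 1∤n = ⊥-elim (1∤n (divides n (≡.sym (ℕ.*-identityʳ n))))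
    ^p^e-nonmultiple (suc e) u n p^[1+e]∤n = trans (sym (⊛^-assocʳ u p (p ℕ.^ e) n)) (via-p^e (p ℕ.^ e ∣? n))
      where
      via-p^e : Dec (p ℕ.^ e ∣ n) → ((u ⊛^ p) ⊛^ (p ℕ.^ e)) n ≈ 0#
      via-p^e (no p^e∤n) = ^p^e-nonmultiple e (u ⊛^ p) n p^e∤n
      via-p^e (yes (divides m ≡.refl)) = begin
        ((u ⊛^ p) ⊛^ P) (m ℕ.* P) ≈⟨ reflexive (≡.cong ((u ⊛^ p) ⊛^ P) (ℕ.*-comm m P)) ⟩
        ((u ⊛^ p) ⊛^ P) (P ℕ.* m) ≈⟨ ^p^e-multiple e (u ⊛^ p) m ⟩
        (u ⊛^ p) m ^ P            ≈⟨ ^-congˡ P (^p-nonmultiple u m p∤m) ⟩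
        0# ^ P                    ≈⟨ 0^n≈0 (ℕ.m^n>0 p e) ⟩
        0#                        ∎
        where
        P : ℕ
        P = p ℕ.^ e
        p∤m : ¬ (p ∣ m)
        p∤m (divides k ≡.refl) = p^[1+e]∤n (divides k (ℕ.*-assoc k p P))

module PowersOf {q} (1<q : 1 < q) where

  instance
    q≢0 : NonZero q
    q≢0 = ℕ.>-nonZero (ℕ.<-trans (s≤s z≤n) 1<q)

  ^-injective : ∀ {a b} → q ℕ.^ a ≡ q ℕ.^ b → a ≡ b
  ^-injective {a} {b} q^a≡q^b with ℕ.<-cmp a b
  ... | tri< a<b _ _ = ⊥-elim (ℕ.<⇒≢ (ℕ.^-monoʳ-< q 1<q a<b) q^a≡q^b)
  ... | tri≈ _ a≡b _ = a≡b
  ... | tri> _ _ b<a = ⊥-elim (ℕ.>⇒≢ (ℕ.^-monoʳ-< q 1<q b<a) q^a≡q^b)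

  ^-<-reflect : ∀ {a b} → q ℕ.^ a < q ℕ.^ b → a < b
  ^-<-reflect {a} {b} q^a<q^b = ℕ.≰⇒> λ b≤a → ℕ.<⇒≱ q^a<q^b (ℕ.^-monoʳ-≤ q b≤a)

  n<q^n : ∀ n → n < q ℕ.^ n
  n<q^n zero    = s≤s z≤n
  n<q^n (suc n) = ℕ.≤-trans (ℕ.+-mono-≤ (ℕ.m^n>0 q n) (n<q^n n))
    (ℕ.≤-trans (ℕ.≤-reflexive (≡.cong (q ℕ.^ n ℕ.+_) (≡.sym (ℕ.+-identityʳ _)))) (ℕ.*-monoˡ-≤ (q ℕ.^ n) 1<q))

  sumFinℕ-powers< : ∀ {k s} → 1 ≤ k → s < q → (e : Fin s → ℕ) → (∀ i → e i < k) →
                    sumFinℕ s (λ i → q ℕ.^ e i) < q ℕ.^ k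
  sumFinℕ-powers< {k} {s} 1≤k s<q e e<k =
    ℕ.≤-<-trans (bound s e e<k) (≡.subst (s ℕ.* q′ <_) q*q′≡q^k (ℕ.*-monoˡ-< q′ {{ℕ.m^n≢0 q (k ∸ 1)}} s<q))
    where
    q′ : ℕ
    q′ = q ℕ.^ (k ∸ 1)
    q*q′≡q^k : q ℕ.* q′ ≡ q ℕ.^ k
    q*q′≡q^k = ≡.cong (q ℕ.^_) (ℕ.m+[n∸m]≡n 1≤k)
    bound : ∀ s (e : Fin s → ℕ) → (∀ i → e i < k) → sumFinℕ s (λ i → q ℕ.^ e i) ≤ s ℕ.* q′
    bound zero    e _   = z≤n
    bound (suc s) e e<k = ℕ.+-mono-≤ (ℕ.^-monoʳ-≤ q (ℕ.≤-pred (≡.subst (e Fin.zero <_) (≡.sym (ℕ.m+[n∸m]≡n 1≤k)) (e<k Fin.zero))))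
                                     (bound s (e ∘ Fin.suc) (e<k ∘ Fin.suc))

  power? : ∀ n → Dec (∃ λ e → q ℕ.^ e ≡ n)
  power? n = map′ (λ (i , q^i≡n) → toℕ i , q^i≡n) bounded (Fin.any? λ i → q ℕ.^ toℕ i ℕ.≟ n)
    where
    bounded : ∃ (λ e → q ℕ.^ e ≡ n) → ∃ λ (i : Fin (suc n)) → q ℕ.^ toℕ i ≡ n
    bounded (e , q^e≡n) = Fin.fromℕ< e<1+n , ≡.trans (≡.cong (q ℕ.^_) (Fin.toℕ-fromℕ< e<1+n)) q^e≡n
      where
      e<1+n : e < suc n
      e<1+n = ℕ.m<n⇒m<1+n (≡.subst (e <_) q^e≡n (n<q^n e))

module QSeries {c ℓ} (R : CommutativeRing c ℓ) {q} (1<q : 1 < q) where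

  open CommutativeRing R hiding (zero)
  open PowerSeries R
  open PowersOf 1<q

  private
    -- The summand of qSeries is local to its definition; unification names it.
    summand : ∀ h n → ∃ λ g → qSeries R q h n ≡ sumTo R g n
    summand h n = _ , ≡.refl

    summand≈δ : ∀ h n i → proj₁ (summand h n) i ≈ δ (q ℕ.^ i) n (h i)
    summand≈δ h n i with q ℕ.^ i ℕ.≟ n
    ... | yes _ = refl
    ... | no  _ = refl

  qSeries-as-∑ : ∀ h n → qSeries R q h n ≈ (∑[ i < suc n ] δ (q ℕ.^ i) n (h i))
  qSeries-as-∑ h n = trans (sumTo≈∑ _ n) (∑-cong′ (suc n) (summand≈δ h n))

  qSeries-power : ∀ h e → qSeries R q h (q ℕ.^ e) ≈ h e
  qSeries-power h e = trans (qSeries-as-∑ h (q ℕ.^ e))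
    (trans (∑-single _ _ e (ℕ.m<n⇒m<1+n (n<q^n e)) λ i _ i≢e →
              δ-≢ (q ℕ.^ i) (q ℕ.^ e) (h i) (i≢e ∘ ^-injective))
           (δ-≡ (q ℕ.^ e) (q ℕ.^ e) (h e) ≡.refl))

  qSeries-nonpower : ∀ h n → ¬ (∃ λ e → q ℕ.^ e ≡ n) → qSeries R q h n ≈ 0#
  qSeries-nonpower h n nonpower = trans (qSeries-as-∑ h n)
    (∑-zero (suc n) λ i _ → δ-≢ (q ℕ.^ i) n (h i) λ q^i≡n → nonpower (i , q^i≡n))

  qSeries-0 : ∀ h → qSeries R q h 0 ≈ 0#
  qSeries-0 h = qSeries-nonpower h 0 λ (e , q^e≡0) → ℕ.<⇒≢ (ℕ.m^n>0 q e) (≡.sym q^e≡0)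

  qSeries-1 : ∀ h → qSeries R q h 1 ≈ h 0
  qSeries-1 h = qSeries-power h 0

module Vanishing {c ℓ} (R : CommutativeRing c ℓ) {p} (p-prime : Prime p) (ιp≈0 : CommutativeRing._≈_ R (ι R p) (CommutativeRing.0# R))
                 (G : ℕ → CommutativeRing.Carrier R)
                 (G-shape : ∀ n → n ≢ 1 → ¬ (p ∣ n) → CommutativeRing._≈_ R (G n) (CommutativeRing.0# R)) where

  open CommutativeRing R hiding (zero)
  open PowerSeries R
  open SeriesFrobenius R p-prime using (p≢0; ^p-multiple; ^p-nonmultiple)
  open import Algebra.Properties.Semiring.Exp semiring using (_^_; ^-congˡ)
  open import Algebra.Properties.Semiring.Exp (CommutativeRing.semiring powerSeriesRing)
    using () renaming (^-homo-* to ⊛^-homo-*; ^-assocʳ to ⊛^-assocʳ)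
  open import Relation.Binary.Reasoning.Setoid setoid
  open import Data.Nat.DivMod using (_%_; _/_; %-distribˡ-+; m%n≤m; m<n⇒m%n≡m; [m+kn]%n≡m%n; m≡m%n+[m/n]*n; m%n<n; m*n%n≡0)
  module S = CommutativeRing powerSeriesRing

  Residue< Residue≤ : ℕ → ℕ → Set
  Residue< a n = n % p < a
  Residue≤ a n = n % p ≤ a

  %-+-≤ : ∀ i j → (i ℕ.+ j) % p ≤ i % p ℕ.+ j % p
  %-+-≤ i j = ≡.subst (_≤ i % p ℕ.+ j % p) (≡.sym (%-distribˡ-+ i j p)) (m%n≤m _ p)

  residue<-+-≤ : ∀ {a b i j} → Residue< a i → Residue≤ b j → Residue< (a ℕ.+ b) (i ℕ.+ j)
  residue<-+-≤ {i = i} {j} i<a j≤b = ℕ.≤-<-trans (%-+-≤ i j) (ℕ.+-mono-<-≤ i<a j≤b)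

  residue≤-+-< : ∀ {a b i j} → Residue≤ a i → Residue< b j → Residue< (a ℕ.+ b) (i ℕ.+ j)
  residue≤-+-< {i = i} {j} i≤a j<b = ℕ.≤-<-trans (%-+-≤ i j) (ℕ.+-mono-≤-< i≤a j<b)

  ¬Residue<1⇒∤ : ∀ {n} → ¬ Residue< 1 n → ¬ (p ∣ n)
  ¬Residue<1⇒∤ ¬n%p<1 (divides j ≡.refl) = ¬n%p<1 (≡.subst (_< 1) (≡.sym (m*n%n≡0 j p)) (s≤s z≤n))

  p-power-supported : ∀ u → SupportedIn (Residue< 1) (u ⊛^ p)
  p-power-supported u n ¬n%p<1 = ^p-nonmultiple ιp≈0 u n (¬Residue<1⇒∤ ¬n%p<1)

  monomial-supported : ∀ x d → SupportedIn (Residue≤ d) (monomial x d)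
  monomial-supported x d n ¬n%p≤d =
    δ-≢ n d x λ n≡d → ¬n%p≤d (≡.subst (λ k → k % p ≤ d) (≡.sym n≡d) (m%n≤m d p))

  c₁ : Carrier
  c₁ = G 1

  rest : Series
  rest = G ⊕ ⊝ monomial c₁ 1

  G≋ : G ≋ monomial c₁ 1 ⊕ rest
  G≋ n = sym (trans (+-congˡ (+-comm _ _)) (trans (sym (+-assoc _ _ _))
                    (trans (+-congʳ (-‿inverseʳ _)) (+-identityˡ _))))

  rest-supported : SupportedIn (Residue< 1) rest
  rest-supported (suc zero)    _        = trans (+-congˡ (-‿cong (δ-≡ 1 1 c₁ ≡.refl))) (-‿inverseʳ c₁)
  rest-supported zero          ¬0%p<1   = ⊥-elim (¬0%p<1 (≡.subst (_< 1) (≡.sym (m<n⇒m%n≡m (ℕ.>-nonZero⁻¹ p))) (s≤s z≤n)))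
  rest-supported (suc (suc k)) ¬n%p<1   =
    trans (+-cong (G-shape _ (λ ()) (¬Residue<1⇒∤ ¬n%p<1)) (-‿cong (δ-≢ (suc (suc k)) 1 c₁ λ ())))
          (trans (+-identityˡ _) -0#≈0#)
    where open import Algebra.Properties.Ring ring using (-0#≈0#)

  lower : ℕ → Series
  lower zero    = 𝟘
  lower (suc y) = monomial c₁ 1 ⊛ lower y ⊕ rest ⊛ monomial (c₁ ^ y) y ⊕ rest ⊛ lower y

  private
    expand : ∀ u v w x → (u ⊕ v) ⊛ (w ⊕ x) ≋ u ⊛ w ⊕ (u ⊛ x ⊕ v ⊛ w ⊕ v ⊛ x)
    expand u v w x = S.trans (S.distribʳ (w ⊕ x) u v) (S.trans (S.+-cong (S.distribˡ u w x) (S.distribˡ v w x))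
                       (S.trans (S.+-assoc _ _ _) (S.+-congˡ (S.sym (S.+-assoc _ _ _)))))

  -- The summand c₁ʸ zʸ is the only one of residue y mod p: G = c₁ z + (terms of degree ≡ 0 mod p).
  ^-split : ∀ y → G ⊛^ y ≋ monomial (c₁ ^ y) y ⊕ lower y
  ^-split zero    n = trans (𝟙≋monomial n) (sym (+-identityʳ _))
  ^-split (suc y) n = begin
    (G ⊛ G ⊛^ y) n
      ≈⟨ ⊛-cong G≋ (^-split y) n ⟩
    ((monomial c₁ 1 ⊕ rest) ⊛ (monomial (c₁ ^ y) y ⊕ lower y)) n
      ≈⟨ expand (monomial c₁ 1) rest (monomial (c₁ ^ y) y) (lower y) n ⟩
    (monomial c₁ 1 ⊛ monomial (c₁ ^ y) y ⊕ lower (suc y)) n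
      ≈⟨ +-congʳ (monomial-⊛-monomial c₁ (c₁ ^ y) 1 y n) ⟩
    (monomial (c₁ ^ suc y) (suc y) ⊕ lower (suc y)) n ∎

  lower-supported : ∀ y → SupportedIn (Residue< y) (lower y)
  lower-supported zero    _ _ = refl
  lower-supported (suc y) =
    ⊕-supportedIn (⊕-supportedIn
      (⊛-supportedIn (λ n → n % p ℕ.≤? 1) (λ n → n % p ℕ.<? y)
                     (monomial-supported c₁ 1) (lower-supported y) residue≤-+-<)
      (⊛-supportedIn (λ n → n % p ℕ.<? 1) (λ n → n % p ℕ.≤? y)
                     rest-supported (monomial-supported (c₁ ^ y) y) residue<-+-≤))
      (⊛-supportedIn (λ n → n % p ℕ.<? 1) (λ n → n % p ℕ.≤? y)
                     rest-supported (supportedIn-weaken ℕ.<⇒≤ (lower-supported y)) residue<-+-≤)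

  lower⊛p-power : ∀ y u n → y ≤ n % p → (lower y ⊛ u ⊛^ p) n ≈ 0#
  lower⊛p-power y u n y≤n%p =
    ⊛-supportedIn {S = Residue< y} (λ n → n % p ℕ.<? y) (λ n → n % p ℕ.<? 1) (lower-supported y) (p-power-supported u)
      (λ {i} {j} i<y j<1 → ≡.subst (λ b → Residue< b (i ℕ.+ j)) (ℕ.+-identityʳ y) (residue<-+-≤ i<y (ℕ.≤-pred j<1)))
      n (ℕ.≤⇒≯ y≤n%p)

  p₋ : ℕ
  p₋ = p ∸ 1

  p≡1+p₋ : p ≡ suc p₋
  p≡1+p₋ = ≡.sym (ℕ.suc-pred p)

  p₋<p : p₋ < p
  p₋<p = ≡.subst (p₋ <_) (≡.sym p≡1+p₋) ℕ.≤-refl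

  private
    digits : ∀ a b → suc a ℕ.* suc b ∸ 1 ≡ a ℕ.+ b ℕ.* suc a
    digits a b = ≡.cong ℕ.pred (product a b)
      where
      product : ∀ a b → suc a ℕ.* suc b ≡ suc (a ℕ.+ b ℕ.* suc a)
      product = solve-∀

    quotient-bound : ∀ a b Y′ → suc (a ℕ.+ Y′ ℕ.* suc a) < suc a ℕ.* suc b → Y′ < b
    quotient-bound a b Y′ bound =
      ℕ.*-cancelʳ-< (suc a) Y′ b (ℕ.+-cancelˡ-≤ (suc a) _ _ (≡.subst₂ _≤_ (lhs a Y′) (rhs a b) bound))
      where
      lhs : ∀ a Y′ → suc (suc (a ℕ.+ Y′ ℕ.* suc a)) ≡ suc a ℕ.+ suc (Y′ ℕ.* suc a)
      lhs = solve-∀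
      rhs : ∀ a b → suc a ℕ.* suc b ≡ suc a ℕ.+ b ℕ.* suc a
      rhs = solve-∀

    p^r≡1+[p^r∸1] : ∀ r → p ℕ.^ r ≡ suc (p ℕ.^ r ∸ 1)
    p^r≡1+[p^r∸1] r = ≡.sym (ℕ.suc-pred (p ℕ.^ r) {{ℕ.m^n≢0 p r}})

  p^[1+r]∸1≡ : ∀ r → p ℕ.^ suc r ∸ 1 ≡ p₋ ℕ.+ (p ℕ.^ r ∸ 1) ℕ.* p
  p^[1+r]∸1≡ r = ≡.trans (≡.cong₂ (λ u v → u ℕ.* v ∸ 1) p≡1+p₋ (p^r≡1+[p^r∸1] r))
                         (≡.trans (digits p₋ _) (≡.cong (λ u → p₋ ℕ.+ (p ℕ.^ r ∸ 1) ℕ.* u) (≡.sym p≡1+p₋)))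

  quotient-bound-p^r : ∀ r Y′ → suc (p₋ ℕ.+ Y′ ℕ.* p) < p ℕ.^ suc r → suc Y′ < p ℕ.^ r
  quotient-bound-p^r r Y′ bound = ≡.subst (suc Y′ <_) (≡.sym (p^r≡1+[p^r∸1] r)) (s≤s (quotient-bound p₋ _ Y′
    (≡.subst₂ (λ u v → suc (p₋ ℕ.+ Y′ ℕ.* u) < u ℕ.* v) p≡1+p₋ (p^r≡1+[p^r∸1] r) bound)))

  residue : ∀ c N → c < p → (c ℕ.+ N ℕ.* p) % p ≡ c
  residue c N c<p = ≡.trans ([m+kn]%n≡m%n c N p) (m<n⇒m%n≡m c<p)

  monomial⊛p-power-off-residue : ∀ x y u N → y < p₋ → (monomial x y ⊛ u ⊛^ p) (p₋ ℕ.+ N ℕ.* p) ≈ 0#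
  monomial⊛p-power-off-residue x y u N y<p₋ =
    trans (⊛-comm (monomial x y) (u ⊛^ p) (p₋ ℕ.+ N ℕ.* p)) (trans (⊛-monomial-≤ (u ⊛^ p) x y≤n) (trans (*-congʳ vanishes) (zeroˡ x)))
    where
    y≤n : y ≤ p₋ ℕ.+ N ℕ.* p
    y≤n = ℕ.≤-trans (ℕ.<⇒≤ y<p₋) (ℕ.m≤m+n p₋ _)
    n∸y≡ : p₋ ℕ.+ N ℕ.* p ∸ y ≡ (p₋ ∸ y) ℕ.+ N ℕ.* p
    n∸y≡ = ℕ.+-∸-comm (N ℕ.* p) (ℕ.<⇒≤ y<p₋)
    vanishes : (u ⊛^ p) (p₋ ℕ.+ N ℕ.* p ∸ y) ≈ 0#
    vanishes = p-power-supported u _ λ residue<1 → ℕ.<⇒≱ (ℕ.m<n⇒0<n∸m y<p₋) (ℕ.≤-pred (≡.subst (_< 1)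
      (≡.trans (≡.cong (_% p) n∸y≡) (residue (p₋ ∸ y) N (ℕ.≤-<-trans (ℕ.m∸n≤m p₋ y) p₋<p))) residue<1))

  monomial⊛p-power-top : ∀ x u N → (monomial x p₋ ⊛ u ⊛^ p) (p₋ ℕ.+ N ℕ.* p) ≈ u N ^ p * x
  monomial⊛p-power-top x u N =
    trans (⊛-comm (monomial x p₋) (u ⊛^ p) (p₋ ℕ.+ N ℕ.* p)) (trans (⊛-monomial-≤ (u ⊛^ p) x (ℕ.m≤m+n p₋ (N ℕ.* p)))
      (*-congʳ (trans (reflexive (≡.cong (u ⊛^ p) (≡.trans (ℕ.m+n∸m≡n p₋ (N ℕ.* p)) (ℕ.*-comm N p))))
                      (^p-multiple ιp≈0 u N))))

  -- Writing Y = y + Y′ p with y < p gives Gʸ (G^Y′)ᵖ. The index p ^ (1 + r) - 1 has residue p - 1,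
  -- which only c₁ʸ zʸ with y = p - 1 can reach, and then the remaining index is p (p ^ r - 1).
  ^-vanishes-at-p^r∸1 : ∀ r Y → suc Y < p ℕ.^ r → (G ⊛^ Y) (p ℕ.^ r ∸ 1) ≈ 0#
  ^-vanishes-at-p^r∸1 zero    Y (s≤s ())
  ^-vanishes-at-p^r∸1 (suc r) Y bound = begin
    (G ⊛^ Y) n                                      ≈⟨ reflexive (≡.cong (λ k → (G ⊛^ k) n) Y≡) ⟩
    (G ⊛^ (y ℕ.+ Y′ ℕ.* p)) n                       ≈⟨ ⊛^-homo-* G y (Y′ ℕ.* p) n ⟩
    (G ⊛^ y ⊛ G ⊛^ (Y′ ℕ.* p)) n                    ≈⟨ ⊛-cong (^-split y) (S.sym (⊛^-assocʳ G Y′ p)) n ⟩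
    ((monomial (c₁ ^ y) y ⊕ lower y) ⊛ T) n         ≈⟨ S.distribʳ T _ _ n ⟩
    (monomial (c₁ ^ y) y ⊛ T) n + (lower y ⊛ T) n   ≈⟨ +-cong (monomial-part (y ℕ.<? p₋)) (lower⊛p-power y (G ⊛^ Y′) n y≤n%p) ⟩
    0# + 0#                                         ≈⟨ +-identityˡ 0# ⟩
    0#                                              ∎
    where
    y : ℕ
    y = Y % p
    Y′ : ℕ
    Y′ = Y / p
    Y≡ : Y ≡ y ℕ.+ Y′ ℕ.* p
    Y≡ = m≡m%n+[m/n]*n Y p
    n : ℕ
    n = p ℕ.^ suc r ∸ 1
    T : Series
    T = (G ⊛^ Y′) ⊛^ p
    y≤p₋ : y ≤ p₋
    y≤p₋ = ℕ.≤-pred (≡.subst (y <_) p≡1+p₋ (m%n<n Y p))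
    y≤n%p : y ≤ n % p
    y≤n%p = ≡.subst (y ≤_) (≡.sym (≡.trans (≡.cong (_% p) (p^[1+r]∸1≡ r)) (residue p₋ (p ℕ.^ r ∸ 1) p₋<p))) y≤p₋
    monomial-part : Dec (y < p₋) → (monomial (c₁ ^ y) y ⊛ T) n ≈ 0#
    monomial-part (yes y<p₋) = ≡.subst (λ k → (monomial (c₁ ^ y) y ⊛ T) k ≈ 0#) (≡.sym (p^[1+r]∸1≡ r))
      (monomial⊛p-power-off-residue (c₁ ^ y) y (G ⊛^ Y′) (p ℕ.^ r ∸ 1) y<p₋)
    monomial-part (no y≮p₋) = ≡.subst (λ k → (monomial (c₁ ^ k) k ⊛ T) n ≈ 0#) (≡.sym y≡p₋) (begin
      (monomial (c₁ ^ p₋) p₋ ⊛ T) n                  ≈⟨ reflexive (≡.cong (monomial (c₁ ^ p₋) p₋ ⊛ T) (p^[1+r]∸1≡ r)) ⟩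
      (monomial (c₁ ^ p₋) p₋ ⊛ T) (p₋ ℕ.+ (p ℕ.^ r ∸ 1) ℕ.* p) ≈⟨ monomial⊛p-power-top (c₁ ^ p₋) (G ⊛^ Y′) (p ℕ.^ r ∸ 1) ⟩
      (G ⊛^ Y′) (p ℕ.^ r ∸ 1) ^ p * c₁ ^ p₋           ≈⟨ *-congʳ (^-congˡ p (^-vanishes-at-p^r∸1 r Y′ (quotient-bound-p^r r Y′
                                                          (≡.subst (λ k → suc (k ℕ.+ Y′ ℕ.* p) < p ℕ.^ suc r) y≡p₋
                                                            (≡.subst (λ k → suc k < p ℕ.^ suc r) Y≡ bound))))) ⟩
      0# ^ p * c₁ ^ p₋                                ≈⟨ trans (*-congʳ (RingLemmas.0^n≈0 R (ℕ.>-nonZero⁻¹ p))) (zeroˡ _) ⟩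
      0#                                              ∎)
      where
      y≡p₋ : y ≡ p₋
      y≡p₋ = ℕ.≤-antisym y≤p₋ (ℕ.≮⇒≥ y≮p₋)

module QSeriesPowers {c ℓ} (R : CommutativeRing c ℓ) {p m} (p-prime : Prime p) (1≤m : 1 ≤ m)
                     (ιp≈0 : CommutativeRing._≈_ R (ι R p) (CommutativeRing.0# R)) where

  open CommutativeRing R hiding (zero)
  open PowerSeries R
  open SeriesFrobenius R p-prime using (^p^e-multiple; ^p^e-nonmultiple)
  open import Algebra.Properties.Semiring.Exp semiring using (_^_; ^-congˡ)

  q : ℕ
  q = p ℕ.^ m

  1<q : 1 < q
  1<q = ℕ.<-≤-trans (prime≥2 p-prime) (ℕ.≤-trans (ℕ.≤-reflexive (≡.sym (ℕ.^-identityʳ p)))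
                                                  (ℕ.^-monoʳ-≤ p {{ℕ.>-nonZero (ℕ.<-trans (s≤s z≤n) (prime≥2 p-prime))}} 1≤m))

  open PowersOf 1<q public
  open QSeries R 1<q public

  ^q^i-multiple : ∀ i u j → (u ⊛^ (q ℕ.^ i)) (q ℕ.^ i ℕ.* j) ≈ u j ^ (q ℕ.^ i)
  ^q^i-multiple i u j with q ℕ.^ i | ℕ.^-*-assoc p m i
  ... | _ | ≡.refl = ^p^e-multiple ιp≈0 (m ℕ.* i) u j

  ^q^i-nonmultiple : ∀ i u n → ¬ (q ℕ.^ i ∣ n) → (u ⊛^ (q ℕ.^ i)) n ≈ 0#
  ^q^i-nonmultiple i u n with q ℕ.^ i | ℕ.^-*-assoc p m i
  ... | _ | ≡.refl = ^p^e-nonmultiple ιp≈0 (m ℕ.* i) u n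

  qSeries-^q^i-power : ∀ h i e → (qSeries R q h ⊛^ (q ℕ.^ i)) (q ℕ.^ (i ℕ.+ e)) ≈ h e ^ (q ℕ.^ i)
  qSeries-^q^i-power h i e = trans (reflexive (≡.cong (qSeries R q h ⊛^ (q ℕ.^ i)) (ℕ.^-distribˡ-+-* q i e)))
    (trans (^q^i-multiple i (qSeries R q h) (q ℕ.^ e)) (^-congˡ (q ℕ.^ i) (qSeries-power h e)))

  qSeries-^q^i-nonpower : ∀ h i n → (∀ e → q ℕ.^ (i ℕ.+ e) ≢ n) → (qSeries R q h ⊛^ (q ℕ.^ i)) n ≈ 0#
  qSeries-^q^i-nonpower h i n nonpower with q ℕ.^ i ∣? n
  ... | no  q^i∤n = ^q^i-nonmultiple i _ n q^i∤n
  ... | yes (divides j ≡.refl) = begin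
    (qSeries R q h ⊛^ Q) (j ℕ.* Q)  ≈⟨ reflexive (≡.cong (qSeries R q h ⊛^ Q) (ℕ.*-comm j Q)) ⟩
    (qSeries R q h ⊛^ Q) (Q ℕ.* j)  ≈⟨ ^q^i-multiple i (qSeries R q h) j ⟩
    qSeries R q h j ^ Q             ≈⟨ ^-congˡ Q (qSeries-nonpower h j λ (e , q^e≡j) →
                                         nonpower e (≡.trans (ℕ.^-distribˡ-+-* q i e)
                                                    (≡.trans (≡.cong (Q ℕ.*_) q^e≡j) (ℕ.*-comm Q j)))) ⟩
    0# ^ Q                          ≈⟨ RingLemmas.0^n≈0 R (ℕ.m^n>0 q i) ⟩
    0#                              ∎
    where
    Q : ℕ
    Q = q ℕ.^ i
    open import Relation.Binary.Reasoning.Setoid setoid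

  p∣q^[1+e] : ∀ e → p ∣ q ℕ.^ suc e
  p∣q^[1+e] e = ∣-trans p∣q (m∣m*n (q ℕ.^ e))
    where
    p∣p^[1+k] : ∀ k → p ∣ p ℕ.^ suc k
    p∣p^[1+k] k = m∣m*n (p ℕ.^ k)
    p∣q : p ∣ q
    p∣q = ≡.subst (λ k → p ∣ p ℕ.^ k) (ℕ.m+[n∸m]≡n 1≤m) (p∣p^[1+k] (m ∸ 1))

  qSeries-shape : ∀ h n → n ≢ 1 → ¬ (p ∣ n) → qSeries R q h n ≈ 0#
  qSeries-shape h n n≢1 p∤n with power? n
  ... | no  nonpower            = qSeries-nonpower h n nonpower
  ... | yes (zero  , ≡.refl)    = ⊥-elim (n≢1 ≡.refl)
  ... | yes (suc e , ≡.refl)    = ⊥-elim (p∤n (p∣q^[1+e] e))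

  zDeriv-qSeries : ∀ h → zDeriv R (qSeries R q h) ≋ monomial (h 0) 1
  zDeriv-qSeries h n with power? n
  ... | no  nonpower = trans (*-congˡ (qSeries-nonpower h n nonpower))
                             (trans (zeroʳ _) (sym (δ-≢ n 1 (h 0) λ n≡1 → nonpower (0 , ≡.sym n≡1))))
  ... | yes (zero , ≡.refl) = trans (*-cong (+-identityʳ 1#) (qSeries-power h 0))
                                    (trans (*-identityˡ _) (sym (δ-≡ 1 1 (h 0) ≡.refl)))
  ... | yes (suc e , ≡.refl) =
    trans (*-congʳ (RingLemmas.ι-multiple R ιp≈0 (p∣q^[1+e] e)))
          (trans (zeroˡ _) (sym (δ-≢ (q ℕ.^ suc e) 1 (h 0) (ℕ.>⇒≢ (ℕ.^-monoʳ-< q 1<q {0} {suc e} (s≤s z≤n))))))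

module InvertibleCase {c ℓ} (R : CommutativeRing c ℓ) {p m} (p-prime : Prime p) (1≤m : 1 ≤ m)
                      (ιp≈0 : CommutativeRing._≈_ R (ι R p) (CommutativeRing.0# R))
                      (f : ℕ → CommutativeRing.Carrier R) {c₀ : CommutativeRing.Carrier R}
                      (f₀c₀≈1 : CommutativeRing._≈_ R (CommutativeRing._*_ R (f 0) c₀) (CommutativeRing.1# R)) where

  open CommutativeRing R hiding (zero)
  open PowerSeries R
  open QSeriesPowers R p-prime 1≤m ιp≈0
  open import Algebra.Properties.Semiring.Exp semiring using (_^_; ^-congˡ)
  open import Relation.Binary.Reasoning.Setoid setoid

  -- g are the coefficients of the inverse G = ∑ gⱼ z^(qʲ) of f under composition:
  -- ∑_{i ≤ E} fᵢ g_{E-i}^(qⁱ) = [E = 0]. The sum over j < k in equationTerms is spelled out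
  -- recursively so that the course-of-values recursion is structural.
  mutual
    g : ℕ → Carrier
    g zero    = c₀
    g (suc E) = - (c₀ * equationTerms (suc E) (suc E))

    equationTerms : ℕ → ℕ → Carrier
    equationTerms N zero    = 0#
    equationTerms N (suc k) = equationTerms N k + f (N ∸ k) * g k ^ (q ℕ.^ (N ∸ k))

  equationTerms≡∑ : ∀ N k → equationTerms N k ≡ (∑[ j < k ] (f (N ∸ j) * g j ^ (q ℕ.^ (N ∸ j))))
  equationTerms≡∑ N zero    = ≡.refl
  equationTerms≡∑ N (suc k) = ≡.cong (_+ f (N ∸ k) * g k ^ (q ℕ.^ (N ∸ k))) (equationTerms≡∑ N k)

  g-equation₀ : f 0 * g 0 ^ (q ℕ.^ 0) ≈ 1#
  g-equation₀ = trans (*-congˡ (*-identityʳ c₀)) f₀c₀≈1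

  g-equation : ∀ E → (∑[ i < suc (suc E) ] (f i * g (suc E ∸ i) ^ (q ℕ.^ i))) ≈ 0#
  g-equation E = begin
    (∑[ i < suc N ] (f i * g (N ∸ i) ^ (q ℕ.^ i)))
      ≈⟨ ∑-reverse _ N ⟩
    (∑[ j < suc N ] (f (N ∸ j) * g (N ∸ (N ∸ j)) ^ (q ℕ.^ (N ∸ j))))
      ≈⟨ ∑-cong (suc N) (λ j j≤N → *-congˡ (reflexive (≡.cong (λ l → g l ^ (q ℕ.^ (N ∸ j))) (ℕ.m∸[m∸n]≡n (ℕ.≤-pred j≤N))))) ⟩
    (∑[ j < N ] (f (N ∸ j) * g j ^ (q ℕ.^ (N ∸ j)))) + f (N ∸ N) * g N ^ (q ℕ.^ (N ∸ N))
      ≈⟨ +-cong (reflexive (≡.sym (equationTerms≡∑ N N)))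
                (reflexive (≡.cong (λ l → f l * g N ^ (q ℕ.^ l)) (ℕ.n∸n≡0 N))) ⟩
    equationTerms N N + f 0 * (- (c₀ * equationTerms N N) * 1#)
      ≈⟨ +-congˡ (trans (*-congˡ (*-identityʳ _)) (trans (sym (-‿distribʳ-* _ _))
                   (-‿cong (trans (sym (*-assoc _ _ _)) (trans (*-congʳ f₀c₀≈1) (*-identityˡ _)))))) ⟩
    equationTerms N N - equationTerms N N
      ≈⟨ -‿inverseʳ _ ⟩
    0# ∎
    where
    N : ℕ
    N = suc E
    open import Algebra.Properties.Ring ring using (-‿distribʳ-*)

  G : Series
  G = qSeries R q g

  f∘G : ℕ → Series
  f∘G k n = ∑[ i < k ] (f i * (G ⊛^ (q ℕ.^ i)) n)

  z : Series
  z = monomial 1# 1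

  f∘G≈z : ∀ k n → n < q ℕ.^ k → f∘G k n ≈ z n
  f∘G≈z k n n<q^k with power? n
  ... | no nonpower =
    trans (∑-zero k λ i _ → trans (*-congˡ (qSeries-^q^i-nonpower g i n λ e q^[i+e]≡n → nonpower (i ℕ.+ e , q^[i+e]≡n)))
                                  (zeroʳ _))
          (sym (δ-≢ n 1 1# λ n≡1 → nonpower (0 , ≡.sym n≡1)))
  ... | yes (E , ≡.refl) = begin
    (∑[ i < k ] (f i * (G ⊛^ (q ℕ.^ i)) (q ℕ.^ E)))
      ≈⟨ ∑-extend _ E<k (λ i E<i _ → trans (*-congˡ (qSeries-^q^i-nonpower g i _ λ e q^[i+e]≡q^E →
                                           ℕ.<⇒≢ (ℕ.<-≤-trans E<i (ℕ.m≤m+n i e)) (≡.sym (^-injective q^[i+e]≡q^E))))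
                                        (zeroʳ _)) ⟨
    (∑[ i < suc E ] (f i * (G ⊛^ (q ℕ.^ i)) (q ℕ.^ E)))
      ≈⟨ ∑-cong (suc E) (λ i i≤E → *-congˡ (trans
           (reflexive (≡.cong (G ⊛^ (q ℕ.^ i)) (≡.cong (q ℕ.^_) (≡.sym (ℕ.m+[n∸m]≡n (ℕ.≤-pred i≤E))))))
                                                     (qSeries-^q^i-power g i (E ∸ i)))) ⟩
    (∑[ i < suc E ] (f i * g (E ∸ i) ^ (q ℕ.^ i)))
      ≈⟨ inverse E ⟩
    z (q ℕ.^ E) ∎
    where
    E<k : suc E ≤ k
    E<k = ^-<-reflect n<q^k
    inverse : ∀ E → (∑[ i < suc E ] (f i * g (E ∸ i) ^ (q ℕ.^ i))) ≈ z (q ℕ.^ E)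
    inverse zero    = trans (+-identityˡ _) (trans g-equation₀ (sym (δ-≡ 1 1 1# ≡.refl)))
    inverse (suc E) = trans (g-equation E) (sym (δ-≢ _ 1 1# (ℕ.>⇒≢ (ℕ.^-monoʳ-< q 1<q {0} {suc E} (s≤s z≤n)))))

  G₀≈0 : G 0 ≈ 0#
  G₀≈0 = qSeries-0 g

  module _ (k : ℕ) (1≤k : 1 ≤ k) where

    Q Q′ : ℕ
    Q  = q ℕ.^ k
    Q′ = Q ∸ 1

    Q≡1+Q′ : Q ≡ suc Q′
    Q≡1+Q′ = ≡.sym (ℕ.suc-pred Q {{ℕ.m^n≢0 q k}})

    headSum : Series → Carrier
    headSum u = ∑[ n < Q ] u n

    headSum-last : ∀ u → headSum u ≈ (∑[ n < Q′ ] u n) + u Q′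
    headSum-last u = reflexive (≡.cong (λ N → sumBelow N u) Q≡1+Q′)

    coefficientSum : ℕ → Carrier
    coefficientSum Y = headSum (G ⊛^ Y)

    coefficientSum-vanishes : ∀ Y → Q ≤ Y → coefficientSum Y ≈ 0#
    coefficientSum-vanishes Y Q≤Y = ∑-zero Q λ n n<Q → ^-vanishes-below G₀≈0 Y n (ℕ.<-≤-trans n<Q Q≤Y)

    coefficientSum-Q′ : coefficientSum Q′ ≈ c₀ ^ Q′
    coefficientSum-Q′ = begin
      coefficientSum Q′                                 ≈⟨ headSum-last (G ⊛^ Q′) ⟩
      (∑[ n < Q′ ] (G ⊛^ Q′) n) + (G ⊛^ Q′) Q′          ≈⟨ +-cong (∑-zero Q′ (^-vanishes-below G₀≈0 Q′)) (^-lowest G₀≈0 Q′) ⟩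
      0# + G 1 ^ Q′                                     ≈⟨ trans (+-identityˡ _) (^-congˡ Q′ (qSeries-1 g)) ⟩
      c₀ ^ Q′                                           ∎

    -- Gʸ f(G) ≡ Gʸ z below Q, and the coefficient of Gʸ at Q - 1 vanishes.
    coefficientSum-shift : ∀ Y → suc Y < Q → (∑[ i < k ] (f i * coefficientSum (Y ℕ.+ q ℕ.^ i))) ≈ coefficientSum Y
    coefficientSum-shift Y 1+Y<Q = begin
      (∑[ i < k ] (f i * coefficientSum (Y ℕ.+ q ℕ.^ i)))
        ≈⟨ ∑-cong′ k (λ i → trans (*-distribˡ-∑ (f i) _ Q) (∑-cong′ Q λ n → *-congˡ (⊛^-homo-* G Y (q ℕ.^ i) n))) ⟩
      (∑[ i < k ] ∑[ n < Q ] (f i * (P ⊛ G ⊛^ (q ℕ.^ i)) n))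
        ≈⟨ ∑-comm _ k Q ⟩
      (∑[ n < Q ] ∑[ i < k ] (f i * (P ⊛ G ⊛^ (q ℕ.^ i)) n))
        ≈⟨ ∑-cong′ Q (λ n → sym (⊛-∑ʳ P f (λ i → G ⊛^ (q ℕ.^ i)) k n)) ⟩
      headSum (P ⊛ f∘G k)
        ≈⟨ ∑-cong Q (λ n n<Q → ⊛-coeff-local n (λ _ _ → refl) λ i i≤n → f∘G≈z k i (ℕ.≤-<-trans i≤n n<Q)) ⟩
      headSum (P ⊛ z)
        ≈⟨ reflexive (≡.cong (λ N → sumBelow N (P ⊛ z)) Q≡1+Q′) ⟩
      (∑[ n < suc Q′ ] (P ⊛ z) n)
        ≈⟨ ∑-splitFirst _ Q′ ⟩
      (P ⊛ z) 0 + (∑[ n < Q′ ] (P ⊛ z) (suc n))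
        ≈⟨ +-cong (⊛-monomial-> P 1# {1} {0} (s≤s z≤n))
                  (∑-cong′ Q′ λ n → trans (⊛-monomial-≤ P 1# {1} {suc n} (s≤s z≤n)) (*-identityʳ _)) ⟩
      0# + (∑[ n < Q′ ] P n)
        ≈⟨ +-identityˡ _ ⟩
      (∑[ n < Q′ ] P n)
        ≈⟨ sym (+-identityʳ _) ⟩
      (∑[ n < Q′ ] P n) + 0#
        ≈⟨ +-congˡ (sym top-vanishes) ⟩
      (∑[ n < Q′ ] P n) + P Q′
        ≈⟨ sym (headSum-last P) ⟩
      coefficientSum Y ∎
      where
      P : Series
      P = G ⊛^ Y
      open import Algebra.Properties.Semiring.Exp (CommutativeRing.semiring powerSeriesRing)
        using () renaming (^-homo-* to ⊛^-homo-*)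
      Q≡p^[mk] : Q ≡ p ℕ.^ (m ℕ.* k)
      Q≡p^[mk] = ℕ.^-*-assoc p m k
      top-vanishes : P Q′ ≈ 0#
      top-vanishes = ≡.subst (λ N → P (N ∸ 1) ≈ 0#) (≡.sym Q≡p^[mk])
        (Vanishing.^-vanishes-at-p^r∸1 R p-prime ιp≈0 G (qSeries-shape g) (m ℕ.* k) Y (≡.subst (suc Y <_) Q≡p^[mk] 1+Y<Q))

    q′ : ℕ
    q′ = q ℕ.^ (k ∸ 1)

    Q≡q*q′ : Q ≡ q ℕ.* q′
    Q≡q*q′ = ≡.cong (q ℕ.^_) (≡.sym (ℕ.m+[n∸m]≡n 1≤k))

    Within : ℕ → ℕ → Set
    Within r n = n < Q → n ≤ r ℕ.* q′

    Within? : ∀ r n → Dec (Within r n)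
    Within? r n with n ℕ.<? Q | n ℕ.≤? r ℕ.* q′
    ... | no  n≮Q | _         = yes λ n<Q → ⊥-elim (n≮Q n<Q)
    ... | yes _   | yes n≤rq′ = yes λ _ → n≤rq′
    ... | yes n<Q | no  n≰rq′ = no λ within → n≰rq′ (within n<Q)

    Within-+ : ∀ {r₁ r₂ i j} → Within r₁ i → Within r₂ j → Within (r₁ ℕ.+ r₂) (i ℕ.+ j)
    Within-+ {r₁} {r₂} {i} {j} i-within j-within i+j<Q =
      ℕ.≤-trans (ℕ.+-mono-≤ (i-within (ℕ.≤-<-trans (ℕ.m≤m+n i j) i+j<Q)) (j-within (ℕ.≤-<-trans (ℕ.m≤n+m j i) i+j<Q)))
                (ℕ.≤-reflexive (≡.sym (ℕ.*-distribʳ-+ q′ r₁ r₂)))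

    G^q^e-within : ∀ e → SupportedIn (Within 1) (G ⊛^ (q ℕ.^ e))
    G^q^e-within e n ¬within = qSeries-^q^i-nonpower g e n λ l q^[e+l]≡n → ¬within λ n<Q →
      ≡.subst (_≤ 1 ℕ.* q′) q^[e+l]≡n (≡.subst (q ℕ.^ (e ℕ.+ l) ≤_) (≡.sym (ℕ.*-identityˡ q′))
        (ℕ.^-monoʳ-≤ q (ℕ.≤-pred (≡.subst (e ℕ.+ l <_) (≡.sym (ℕ.m+[n∸m]≡n 1≤k))
                                         (^-<-reflect (≡.subst (_< Q) (≡.sym q^[e+l]≡n) n<Q))))))

    -- Below Q no product of such terms wraps around, since r₁ + r₂ < q.
    headSum-⊛ : ∀ {u v r₁ r₂} → SupportedIn (Within r₁) u → SupportedIn (Within r₂) v → r₁ ℕ.+ r₂ < q →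
                headSum (u ⊛ v) ≈ headSum u * headSum v
    headSum-⊛ {u} {v} {r₁} {r₂} u-within v-within r₁+r₂<q = begin
      headSum (u ⊛ v)
        ≈⟨ ∑-cong Q (λ n n<Q → ⊛-as-double-sum u v n<Q) ⟩
      (∑[ n < Q ] ∑[ i < Q ] ∑[ j < Q ] δ (i ℕ.+ j) n (u i * v j))
        ≈⟨ trans (∑-comm _ Q Q) (∑-cong′ Q λ i → ∑-comm _ Q Q) ⟩
      (∑[ i < Q ] ∑[ j < Q ] ∑[ n < Q ] δ (i ℕ.+ j) n (u i * v j))
        ≈⟨ ∑-cong Q (λ i i<Q → ∑-cong Q λ j j<Q → inner i<Q j<Q) ⟩
      (∑[ i < Q ] ∑[ j < Q ] (u i * v j))
        ≈⟨ ∑-cong′ Q (λ i → sym (*-distribˡ-∑ (u i) v Q)) ⟩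
      (∑[ i < Q ] (u i * headSum v))
        ≈⟨ sym (*-distribʳ-∑ _ u Q) ⟩
      headSum u * headSum v ∎
      where
      wraps-to-zero : ∀ {i j} → i < Q → j < Q → ¬ (i ℕ.+ j < Q) → u i * v j ≈ 0#
      wraps-to-zero {i} {j} i<Q j<Q i+j≮Q with Within? r₁ i | Within? r₂ j
      ... | no ¬i-within | _            = trans (*-congʳ (u-within i ¬i-within)) (zeroˡ _)
      ... | yes _        | no ¬j-within = trans (*-congˡ (v-within j ¬j-within)) (zeroʳ _)
      ... | yes i-within | yes j-within = ⊥-elim (i+j≮Q (ℕ.≤-<-trans (ℕ.+-mono-≤ (i-within i<Q) (j-within j<Q))
          (ℕ.≤-<-trans (ℕ.≤-reflexive (≡.sym (ℕ.*-distribʳ-+ q′ r₁ r₂)))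
                       (≡.subst ((r₁ ℕ.+ r₂) ℕ.* q′ <_) (≡.sym Q≡q*q′) (ℕ.*-monoˡ-< q′ {{ℕ.m^n≢0 q (k ∸ 1)}} r₁+r₂<q)))))
      inner : ∀ {i j} → i < Q → j < Q → (∑[ n < Q ] δ (i ℕ.+ j) n (u i * v j)) ≈ u i * v j
      inner {i} {j} i<Q j<Q with (i ℕ.+ j) ℕ.<? Q
      ... | yes i+j<Q = δ-select i+j<Q (u i * v j)
      ... | no  i+j≮Q = trans (∑-zero Q λ n n<Q → δ-≢ (i ℕ.+ j) n _ λ { ≡.refl → i+j≮Q n<Q })
                              (sym (wraps-to-zero i<Q j<Q i+j≮Q))

    ∏-within : ∀ s (H : Fin s → Series) → (∀ i → SupportedIn (Within 1) (H i)) →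
               SupportedIn (Within s) (prodFin powerSeriesRing s H)
    ∏-within zero    H _          zero    ¬within = ⊥-elim (¬within λ _ → z≤n)
    ∏-within zero    H _          (suc n) _       = refl
    ∏-within (suc s) H H-within =
      ⊛-supportedIn (Within? 1) (Within? s) (H-within Fin.zero) (∏-within s (H ∘ Fin.suc) (H-within ∘ Fin.suc))
                    (Within-+ {1} {s})

    headSum-∏ : ∀ s (H : Fin s → Series) → (∀ i → SupportedIn (Within 1) (H i)) → s < q →
                headSum (prodFin powerSeriesRing s H) ≈ prodFin R s (headSum ∘ H)
    headSum-∏ zero    H _        _   =
      trans (reflexive (≡.cong (λ N → sumBelow N 𝟙) Q≡1+Q′))
            (trans (∑-splitFirst 𝟙 Q′) (trans (+-congˡ (∑-zero Q′ λ _ _ → refl)) (+-identityʳ 1#)))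
    headSum-∏ (suc s) H H-within 1+s<q =
      trans (headSum-⊛ {r₁ = 1} {s} (H-within Fin.zero) (∏-within s (H ∘ Fin.suc) (H-within ∘ Fin.suc)) 1+s<q)
            (*-congˡ (headSum-∏ s (H ∘ Fin.suc) (H-within ∘ Fin.suc) (ℕ.<-trans (ℕ.n<1+n s) 1+s<q)))

    module _ (a : Series) (a-equation : a ⊛ oneMinus R (qSeries R q f) ≋ monomial (f 0) 1) where

      F F≤k : Series
      F = qSeries R q f
      F≤k l = ∑[ i < k ] (f i * monomial 1# (q ℕ.^ i) l)

      a-recurrence′ : ∀ n → a n ≈ δ n 1 (f 0) + (∑[ j < n ] (a j * F (n ∸ j)))
      a-recurrence′ = ⊛-oneMinus⇒recurrence a F (qSeries-0 f) a-equation

      a₀≈0 : a 0 ≈ 0#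
      a₀≈0 = trans (a-recurrence′ 0) (+-identityʳ 0#)

      F≈F≤k : ∀ l → l < Q → F l ≈ F≤k l
      F≈F≤k l l<Q with power? l
      ... | no nonpower = trans (qSeries-nonpower f l nonpower) (sym (∑-zero k λ i _ →
                            trans (*-congˡ (δ-≢ l (q ℕ.^ i) 1# λ l≡q^i → nonpower (i , ≡.sym l≡q^i))) (zeroʳ _)))
      ... | yes (E , ≡.refl) = trans (qSeries-power f E) (sym (trans
                                 (∑-single _ k E (^-<-reflect l<Q) λ i _ i≢E →
                                   trans (*-congˡ (δ-≢ (q ℕ.^ E) (q ℕ.^ i) 1# λ q^E≡q^i → i≢E (^-injective (≡.sym q^E≡q^i))))
                                         (zeroʳ _))
                                 (trans (*-congˡ (δ-≡ (q ℕ.^ E) (q ℕ.^ E) 1# ≡.refl)) (*-identityʳ _))))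

      a-recurrence : ∀ n → n < Q → a n ≈ δ n 1 (f 0) + (∑[ i < k ] (f i * (a ⊛ monomial 1# (q ℕ.^ i)) n))
      a-recurrence n n<Q = begin
        a n                                                    ≈⟨ a-recurrence′ n ⟩
        δ n 1 (f 0) + (∑[ j < n ] (a j * F (n ∸ j)))           ≈⟨ +-congˡ (∑-below≈⊛ a F (qSeries-0 f) n) ⟩
        δ n 1 (f 0) + (a ⊛ F) n                                ≈⟨ +-congˡ (⊛-coeff-local n (λ _ _ → refl) λ l l≤n →
                                                                                        F≈F≤k l (ℕ.≤-<-trans l≤n n<Q)) ⟩
        δ n 1 (f 0) + (a ⊛ F≤k) n                              ≈⟨ +-congˡ (⊛-∑ʳ a f (λ i → monomial 1# (q ℕ.^ i)) k n) ⟩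
        δ n 1 (f 0) + (∑[ i < k ] (f i * (a ⊛ monomial 1# (q ℕ.^ i)) n)) ∎

      private
        ∸-∸≡∸-+ : ∀ {d n} → d ≤ n → n ≤ Q → Q ∸ (n ∸ d) ≡ (Q ∸ n) ℕ.+ d
        ∸-∸≡∸-+ {d} {n} d≤n n≤Q = ≡.trans (≡.cong (_∸ (n ∸ d)) Q≡) (ℕ.m+n∸n≡m ((Q ∸ n) ℕ.+ d) (n ∸ d))
          where
          Q≡ : Q ≡ (Q ∸ n) ℕ.+ d ℕ.+ (n ∸ d)
          Q≡ = ≡.trans (≡.sym (ℕ.m∸n+n≡m n≤Q))
                 (≡.trans (≡.cong ((Q ∸ n) ℕ.+_) (≡.sym (ℕ.m+[n∸m]≡n d≤n))) (≡.sym (ℕ.+-assoc (Q ∸ n) d (n ∸ d))))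

        Q≤Q∸n+d : ∀ {d n} → n ≤ Q → n ≤ d → Q ≤ (Q ∸ n) ℕ.+ d
        Q≤Q∸n+d n≤Q n≤d = ℕ.≤-trans (ℕ.≤-reflexive (≡.sym (ℕ.m∸n+n≡m n≤Q))) (ℕ.+-monoʳ-≤ _ n≤d)

      Formula : ℕ → Set ℓ
      Formula n = 0 < n → n < Q → a n ≈ f 0 ^ Q * coefficientSum (Q ∸ n)

      shifted-term : ∀ {n} → (∀ n′ → n′ < n → Formula n′) → n < Q → ∀ i →
                     (a ⊛ monomial 1# (q ℕ.^ i)) n ≈ f 0 ^ Q * coefficientSum ((Q ∸ n) ℕ.+ q ℕ.^ i)
      shifted-term {n} earlier-formula n<Q i with q ℕ.^ i ℕ.≤? n
      ... | no q^i≰n =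
        trans (⊛-monomial-> a 1# (ℕ.≰⇒> q^i≰n))
              (sym (trans (*-congˡ (coefficientSum-vanishes _ (Q≤Q∸n+d (ℕ.<⇒≤ n<Q) (ℕ.<⇒≤ (ℕ.≰⇒> q^i≰n))))) (zeroʳ _)))
      ... | yes q^i≤n = trans (⊛-monomial-≤ a 1# q^i≤n) (trans (*-identityʳ _) (by-remainder (n ∸ q ℕ.^ i) ≡.refl))
        where
        by-remainder : ∀ r → r ≡ n ∸ q ℕ.^ i → a r ≈ f 0 ^ Q * coefficientSum ((Q ∸ n) ℕ.+ q ℕ.^ i)
        by-remainder zero    0≡n∸q^i = trans a₀≈0 (sym (trans (*-congˡ (coefficientSum-vanishes _
                                         (Q≤Q∸n+d (ℕ.<⇒≤ n<Q) (ℕ.m∸n≡0⇒m≤n (≡.sym 0≡n∸q^i))))) (zeroʳ _)))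
        by-remainder (suc r) 1+r≡n∸q^i =
          trans (earlier-formula (suc r) (≡.subst (_< n) (≡.sym 1+r≡n∸q^i) (ℕ.∸-monoʳ-< (ℕ.m^n>0 q i) q^i≤n)) (s≤s z≤n)
                                 (≡.subst (_< Q) (≡.sym 1+r≡n∸q^i) (ℕ.≤-<-trans (ℕ.m∸n≤m n (q ℕ.^ i)) n<Q)))
                (*-congˡ (reflexive (≡.cong coefficientSum
                  (≡.trans (≡.cong (Q ∸_) 1+r≡n∸q^i) (∸-∸≡∸-+ q^i≤n (ℕ.<⇒≤ n<Q))))))

      -- Lagrange inversion in disguise, using that G′ = g₀ is constant in characteristic p.
      a-formula : ∀ n → Formula n
      a-formula = <-rec Formula λ n earlier-formula → step n λ n′ → earlier-formula {n′}
        where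
        open import Data.Nat.Induction using (<-rec)
        step : ∀ n → (∀ n′ → n′ < n → Formula n′) → Formula n
        step (suc zero) earlier-formula _ 1<Q = begin
          a 1                                                       ≈⟨ a-recurrence 1 1<Q ⟩
          f 0 + (∑[ i < k ] (f i * (a ⊛ monomial 1# (q ℕ.^ i)) 1))  ≈⟨ +-congˡ (∑-zero k λ i _ →
                                                                          trans (*-congˡ (shifted-term earlier-formula 1<Q i))
                                                                                (trans (*-congˡ (trans (*-congˡ (coefficientSum-vanishes _
                                                                                   (Q≤Q∸n+d (ℕ.<⇒≤ 1<Q) (ℕ.m^n>0 q i)))) (zeroʳ _))) (zeroʳ _))) ⟩
          f 0 + 0#                                                  ≈⟨ +-identityʳ _ ⟩
          f 0                                                       ≈⟨ sym base ⟩
          f 0 ^ Q * coefficientSum (Q ∸ 1)                          ∎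
          where
          open import Algebra.Properties.CommutativeSemiring.Exp commutativeSemiring using (^-distrib-*)
          base : f 0 ^ Q * coefficientSum Q′ ≈ f 0
          base = begin
            f 0 ^ Q * coefficientSum Q′              ≈⟨ *-cong (reflexive (≡.cong (f 0 ^_) Q≡1+Q′)) coefficientSum-Q′ ⟩
            f 0 * f 0 ^ Q′ * c₀ ^ Q′                 ≈⟨ *-assoc _ _ _ ⟩
            f 0 * (f 0 ^ Q′ * c₀ ^ Q′)               ≈⟨ *-congˡ (sym (^-distrib-* (f 0) c₀ Q′)) ⟩
            f 0 * (f 0 * c₀) ^ Q′                    ≈⟨ *-congˡ (trans (^-congˡ Q′ f₀c₀≈1) (RingLemmas.1^n≈1 R Q′)) ⟩
            f 0 * 1#                                 ≈⟨ *-identityʳ _ ⟩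
            f 0                                      ∎
        step n@(suc (suc _)) earlier-formula _ n<Q = begin
          a n                                                                   ≈⟨ a-recurrence n n<Q ⟩
          0# + (∑[ i < k ] (f i * (a ⊛ monomial 1# (q ℕ.^ i)) n))              ≈⟨ +-identityˡ _ ⟩
          (∑[ i < k ] (f i * (a ⊛ monomial 1# (q ℕ.^ i)) n))                   ≈⟨ ∑-cong′ k (λ i → *-congˡ (shifted-term earlier-formula n<Q i)) ⟩
          (∑[ i < k ] (f i * (f 0 ^ Q * coefficientSum (Y ℕ.+ q ℕ.^ i))))      ≈⟨ ∑-cong′ k (λ i → x∙yz≈y∙xz _ _ _) ⟩
          (∑[ i < k ] (f 0 ^ Q * (f i * coefficientSum (Y ℕ.+ q ℕ.^ i))))      ≈⟨ sym (*-distribˡ-∑ _ _ k) ⟩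
          f 0 ^ Q * (∑[ i < k ] (f i * coefficientSum (Y ℕ.+ q ℕ.^ i)))        ≈⟨ *-congˡ (coefficientSum-shift Y 1+Y<Q) ⟩
          f 0 ^ Q * coefficientSum Y                                            ∎
          where
          open import Algebra.Properties.CommutativeSemigroup *-commutativeSemigroup using (x∙yz≈y∙xz)
          Y : ℕ
          Y = Q ∸ n
          1+Y<Q : suc Y < Q
          1+Y<Q = ℕ.≤-trans (ℕ.≤-reflexive (ℕ.+-comm 2 Y)) (ℕ.≤-trans (ℕ.+-monoʳ-≤ Y (s≤s (s≤s z≤n)))
                    (ℕ.≤-reflexive (ℕ.m∸n+n≡m (ℕ.<⇒≤ n<Q))))

      a-at-Q∸ : ∀ x → 0 < x → x < Q → a (Q ∸ x) ≈ f 0 ^ Q * coefficientSum x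
      a-at-Q∸ x 0<x x<Q = trans (a-formula (Q ∸ x) (ℕ.m<n⇒0<n∸m x<Q) (ℕ.∸-monoʳ-< 0<x (ℕ.<⇒≤ x<Q)))
                                (*-congˡ (reflexive (≡.cong coefficientSum (ℕ.m∸[m∸n]≡n (ℕ.<⇒≤ x<Q)))))

      product-formula : ∀ s → 1 ≤ s → s < q → (e : Fin s → ℕ) → (∀ i → e i < k) →
        prodFin R s (λ i → a (Q ∸ q ℕ.^ e i)) ≈ f 0 ^ ((s ∸ 1) ℕ.* Q) * a (Q ∸ sumFinℕ s (λ i → q ℕ.^ e i))
      product-formula s 1≤s s<q e e<k = begin
        prodFin R s (λ i → a (Q ∸ d i))
          ≈⟨ ∏-cong s (λ i → a-at-Q∸ (d i) (ℕ.m^n>0 q (e i)) (d<Q i)) ⟩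
        prodFin R s (λ i → f 0 ^ Q * coefficientSum (d i))
          ≈⟨ trans (∏-distrib-* s _ _) (*-congʳ (∏-const s _)) ⟩
        (f 0 ^ Q) ^ s * prodFin R s (λ i → coefficientSum (d i))
          ≈⟨ *-cong (^-assocʳ (f 0) Q s) (sym coefficientSum-Y) ⟩
        f 0 ^ (Q ℕ.* s) * coefficientSum Y
          ≈⟨ *-congʳ (trans (reflexive (≡.cong (f 0 ^_) exponent)) (^-homo-* (f 0) ((s ∸ 1) ℕ.* Q) Q)) ⟩
        f 0 ^ ((s ∸ 1) ℕ.* Q) * f 0 ^ Q * coefficientSum Y
          ≈⟨ *-assoc _ _ _ ⟩
        f 0 ^ ((s ∸ 1) ℕ.* Q) * (f 0 ^ Q * coefficientSum Y)
          ≈⟨ *-congˡ (sym (a-at-Q∸ Y 0<Y Y<Q)) ⟩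
        f 0 ^ ((s ∸ 1) ℕ.* Q) * a (Q ∸ Y) ∎
        where
        open FiniteProducts R using (∏-cong; ∏-distrib-*; ∏-const)
        open import Algebra.Properties.Semiring.Exp semiring using (^-assocʳ; ^-homo-*)
        d : Fin s → ℕ
        d i = q ℕ.^ e i
        Y : ℕ
        Y = sumFinℕ s d
        d<Q : ∀ i → d i < Q
        d<Q i = ℕ.^-monoʳ-< q 1<q (e<k i)
        Y<Q : Y < Q
        Y<Q = sumFinℕ-powers< 1≤k s<q e e<k
        positive : ∀ s → 1 ≤ s → (h : Fin s → ℕ) → (∀ i → 0 < h i) → 0 < sumFinℕ s h
        positive (suc s) _ h h>0 = ℕ.<-≤-trans (h>0 Fin.zero) (ℕ.m≤m+n _ _)
        0<Y : 0 < Y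
        0<Y = positive s 1≤s d (λ i → ℕ.m^n>0 q (e i))
        exponent : Q ℕ.* s ≡ (s ∸ 1) ℕ.* Q ℕ.+ Q
        exponent = ≡.trans (ℕ.*-comm Q s) (≡.trans (≡.cong (ℕ._* Q) (≡.sym (ℕ.m∸n+n≡m 1≤s)))
                     (≡.trans (ℕ.*-distribʳ-+ Q (s ∸ 1) 1) (≡.cong ((s ∸ 1) ℕ.* Q ℕ.+_) (ℕ.+-identityʳ Q))))
        coefficientSum-Y : coefficientSum Y ≈ prodFin R s (λ i → coefficientSum (d i))
        coefficientSum-Y = trans (∑-cong′ Q (FiniteProducts.^-sumFinℕ powerSeriesRing G s d))
                                 (headSum-∏ s (λ i → G ⊛^ d i) (λ i → G^q^e-within (e i)) s<q)

module Homogenization {c ℓ} (R : CommutativeRing c ℓ) {p m} (p-prime : Prime p) (1≤m : 1 ≤ m)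
                      (ιp≈0 : CommutativeRing._≈_ R (ι R p) (CommutativeRing.0# R))
                      (f a : ℕ → CommutativeRing.Carrier R)
                      (a-equation : PowerSeries._≋_ R (_⋆_ R a (oneMinus R (qSeries R (p ℕ.^ m) f)))
                                                      (PowerSeries.monomial R (f 0) 1)) where

  open CommutativeRing R hiding (zero)
  open PowerSeries R
  open QSeriesPowers R p-prime 1≤m ιp≈0 using (q; 1<q; sumFinℕ-powers<)
  open import Algebra.Properties.Semiring.Exp semiring using (_^_)
  open import Relation.Binary.Reasoning.Setoid setoid

  -- Series in z whose coefficients are series in a second variable w.
  module Z = PowerSeries powerSeriesRing
  module QZ = QSeries powerSeriesRing 1<q

  -- f̃ₑ = [e = 0] + fₑ w^(qᵉ), i.e. f̃(z) = z + f(wz); its linear coefficient 1 + f₀ w is a unit.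
  f̃ : ℕ → Series
  f̃ zero    = 𝟙 ⊕ monomial (f 0) 1
  f̃ (suc e) = monomial (f (suc e)) (q ℕ.^ suc e)

  f̃-degree : ∀ e → Degree≤ (q ℕ.^ e) (f̃ e)
  f̃-degree zero    zero          0≰1 = ⊥-elim (0≰1 z≤n)
  f̃-degree zero    (suc zero)    1≰1 = ⊥-elim (1≰1 ℕ.≤-refl)
  f̃-degree zero    (suc (suc n)) _   = +-identityˡ 0#
  f̃-degree (suc e) n n≰q^[1+e]       = δ-≢ n (q ℕ.^ suc e) _ λ n≡ → n≰q^[1+e] (ℕ.≤-reflexive n≡)

  f̃-top : ∀ e → f̃ e (q ℕ.^ e) ≈ f e
  f̃-top zero    = +-identityˡ (f 0)
  f̃-top (suc e) = δ-≡ (q ℕ.^ suc e) (q ℕ.^ suc e) (f (suc e)) ≡.refl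

  c̃ : Series
  c̃ n = (- f 0) ^ n

  f̃₀c̃≈1 : f̃ 0 ⊛ c̃ ≋ 𝟙
  f̃₀c̃≈1 n = trans (Z-distribʳ n) (trans (+-cong (⊛-identityˡ c̃ n) (trans (⊛-comm _ c̃ n) (shifted n))) (cancel n))
    where
    Z-distribʳ : ∀ n → (f̃ 0 ⊛ c̃) n ≈ (𝟙 ⊛ c̃) n + (monomial (f 0) 1 ⊛ c̃) n
    Z-distribʳ = ⊛-distribʳ c̃ 𝟙 (monomial (f 0) 1)
    c̃-shifted : Series
    c̃-shifted zero    = 0#
    c̃-shifted (suc n) = c̃ n * f 0
    shifted : ∀ n → (c̃ ⊛ monomial (f 0) 1) n ≈ c̃-shifted n
    shifted zero    = ⊛-monomial-> c̃ (f 0) {1} {0} (s≤s z≤n)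
    shifted (suc n) = ⊛-monomial-≤ c̃ (f 0) {1} {suc n} (s≤s z≤n)
    cancel : ∀ n → c̃ n + c̃-shifted n ≈ 𝟙 n
    cancel zero    = +-identityʳ 1#
    cancel (suc n) = trans (+-cong (sym (-‿distribˡ-* _ _)) (*-comm _ _)) (-‿inverseˡ _)
      where open import Algebra.Properties.Ring ring using (-‿distribˡ-*)

  F : Series
  F = qSeries R q f

  F̃ : Z.Series
  F̃ = qSeries powerSeriesRing q f̃

  -- The recurrence of a for f̃, by the same structural course-of-values recursion as g.
  mutual
    ã : Z.Series
    ã n = Z.monomial (f̃ 0) 1 n ⊕ recurrenceTerms n n

    recurrenceTerms : ℕ → ℕ → Series
    recurrenceTerms n zero    = 𝟘
    recurrenceTerms n (suc j) = recurrenceTerms n j ⊕ ã j ⊛ F̃ (n ∸ j)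

  recurrenceTerms≡∑ : ∀ n k → recurrenceTerms n k ≡ (Z.∑[ j < k ] (ã j ⊛ F̃ (n ∸ j)))
  recurrenceTerms≡∑ n zero    = ≡.refl
  recurrenceTerms≡∑ n (suc k) = ≡.cong (_⊕ ã k ⊛ F̃ (n ∸ k)) (recurrenceTerms≡∑ n k)

  ã-equation : ã Z.⊛ oneMinus powerSeriesRing F̃ Z.≋ Z.monomial (f̃ 0) 1
  ã-equation = Z.recurrence⇒⊛-oneMinus ã F̃ (QZ.qSeries-0 f̃) λ n k →
    reflexive (≡.cong (λ s → (Z.monomial (f̃ 0) 1 n ⊕ s) k) (recurrenceTerms≡∑ n n))

  open import Data.Product using (_×_)

  Homogeneous : Series → ℕ → Carrier → Set ℓ
  Homogeneous u d x = Degree≤ d u × u d ≈ x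

  F̃-homogeneous : ∀ l → Homogeneous (F̃ l) l (F l)
  F̃-homogeneous l with QSeriesPowers.power? R p-prime 1≤m ιp≈0 l
  ... | yes (e , ≡.refl) = supportedIn-resp-≋ (λ n → sym (QZ.qSeries-power f̃ e n)) (f̃-degree e)
                         , trans (QZ.qSeries-power f̃ e (q ℕ.^ e)) (trans (f̃-top e) (sym (qSeries-power f e)))
    where open QSeries R 1<q using (qSeries-power)
  ... | no nonpower = supportedIn-resp-≋ (λ n → sym (QZ.qSeries-nonpower f̃ l nonpower n)) (λ _ _ → refl)
                    , trans (QZ.qSeries-nonpower f̃ l nonpower l) (sym (qSeries-nonpower f l nonpower))
    where open QSeries R 1<q using (qSeries-nonpower)

  monomial-homogeneous : ∀ n → Homogeneous (Z.monomial (f̃ 0) 1 n) n (monomial (f 0) 1 n)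
  monomial-homogeneous zero          = (λ _ _ → refl) , refl
  monomial-homogeneous (suc zero)    = f̃-degree 0 , f̃-top 0
  monomial-homogeneous (suc (suc n)) = (λ _ _ → refl) , refl

  Z-∑-coeff : ∀ (u : Z.Series) N k → Z.sumBelow N u k ≈ (∑[ j < N ] u j k)
  Z-∑-coeff u zero    k = refl
  Z-∑-coeff u (suc N) k = +-congʳ (Z-∑-coeff u N k)

  ã-homogeneous : ∀ n → Homogeneous (ã n) n (a n)
  ã-homogeneous = <-rec _ λ n earlier-homogeneous → step n λ j → earlier-homogeneous {j}
    where
    open import Data.Nat.Induction using (<-rec)
    step : ∀ n → (∀ j → j < n → Homogeneous (ã j) j (a j)) → Homogeneous (ã n) n (a n)
    step n earlier-homogeneous = ⊕-supportedIn (proj₁ (monomial-homogeneous n)) earlier-degree , top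
      where
      term-degree : ∀ j → j < n → Degree≤ n (ã j ⊛ F̃ (n ∸ j))
      term-degree j j<n = ≡.subst (λ d → Degree≤ d (ã j ⊛ F̃ (n ∸ j))) (ℕ.m+[n∸m]≡n (ℕ.<⇒≤ j<n))
                            (⊛-degree (proj₁ (earlier-homogeneous j j<n)) (proj₁ (F̃-homogeneous (n ∸ j))))
      term-top : ∀ j → j < n → (ã j ⊛ F̃ (n ∸ j)) n ≈ a j * F (n ∸ j)
      term-top j j<n = ≡.subst (λ d → (ã j ⊛ F̃ (n ∸ j)) d ≈ a j * F (n ∸ j)) (ℕ.m+[n∸m]≡n (ℕ.<⇒≤ j<n))
        (trans (⊛-top (proj₁ (earlier-homogeneous j j<n)) (proj₁ (F̃-homogeneous (n ∸ j))))
               (*-cong (proj₂ (earlier-homogeneous j j<n)) (proj₂ (F̃-homogeneous (n ∸ j)))))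
      earlier-degree : Degree≤ n (recurrenceTerms n n)
      earlier-degree k k≰n = trans (reflexive (≡.cong (λ u → u k) (recurrenceTerms≡∑ n n)))
        (trans (Z-∑-coeff _ n k) (∑-zero n λ j j<n → term-degree j j<n k k≰n))
      top : ã n n ≈ a n
      top = begin
        ã n n                                                    ≈⟨ +-congˡ (reflexive (≡.cong (λ u → u n) (recurrenceTerms≡∑ n n))) ⟩
        Z.monomial (f̃ 0) 1 n n + Z.sumBelow n (λ j → ã j ⊛ F̃ (n ∸ j)) n
                                                                 ≈⟨ +-cong (proj₂ (monomial-homogeneous n)) (trans (Z-∑-coeff _ n n) (∑-cong n term-top)) ⟩
        monomial (f 0) 1 n + (∑[ j < n ] (a j * F (n ∸ j)))      ≈⟨ sym (⊛-oneMinus⇒recurrence a F (qSeries-0 f) a-equation n) ⟩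
        a n                                                      ∎
        where open QSeries R 1<q using (qSeries-0)

  private
    sumFinℕ-complement : ∀ Q s (d : Fin s → ℕ) → (∀ i → d i ≤ Q) →
                         sumFinℕ s (λ i → Q ∸ d i) ℕ.+ sumFinℕ s d ≡ s ℕ.* Q
    sumFinℕ-complement Q zero    d _   = ≡.refl
    sumFinℕ-complement Q (suc s) d d≤Q =
      ≡.trans (interchange (Q ∸ d Fin.zero) _ (d Fin.zero) _)
              (≡.cong₂ ℕ._+_ (ℕ.m∸n+n≡m (d≤Q Fin.zero)) (sumFinℕ-complement Q s (d ∘ Fin.suc) (d≤Q ∘ Fin.suc)))
      where open import Algebra.Properties.CommutativeSemigroup ℕ.+-commutativeSemigroup using (interchange)

    sumFinℕ-complement′ : ∀ Q s (d : Fin s → ℕ) → 1 ≤ s → (∀ i → d i ≤ Q) → sumFinℕ s d ≤ Q →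
                          sumFinℕ s (λ i → Q ∸ d i) ≡ (s ∸ 1) ℕ.* Q ℕ.+ (Q ∸ sumFinℕ s d)
    sumFinℕ-complement′ Q s d 1≤s d≤Q Y≤Q =
      ℕ.+-cancelʳ-≡ Y _ _ (≡.trans (sumFinℕ-complement Q s d d≤Q) (≡.sym
        (≡.trans (ℕ.+-assoc ((s ∸ 1) ℕ.* Q) (Q ∸ Y) Y)
        (≡.trans (≡.cong ((s ∸ 1) ℕ.* Q ℕ.+_) (ℕ.m∸n+n≡m Y≤Q))
        (≡.trans (ℕ.+-comm ((s ∸ 1) ℕ.* Q) Q) (≡.cong (ℕ._* Q) (ℕ.m+[n∸m]≡n 1≤s)))))))
      where
      Y : ℕ
      Y = sumFinℕ s d

  product-formula : ∀ s k → 1 ≤ s → s < q → 1 ≤ k → (e : Fin s → ℕ) → (∀ i → e i < k) →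
    prodFin R s (λ i → a (q ℕ.^ k ∸ q ℕ.^ e i)) ≈ f 0 ^ ((s ∸ 1) ℕ.* q ℕ.^ k) * a (q ℕ.^ k ∸ sumFinℕ s (λ i → q ℕ.^ e i))
  product-formula s k 1≤s s<q 1≤k e e<k = begin
    prodFin R s (λ i → a (d i))                   ≈⟨ ∏-cong s (λ i → sym (proj₂ (ã-homogeneous (d i)))) ⟩
    prodFin R s (λ i → ã (d i) (d i))             ≈⟨ sym (∏-top s (ã ∘ d) d (proj₁ ∘ ã-homogeneous ∘ d)) ⟩
    prodFin powerSeriesRing s (ã ∘ d) W           ≈⟨ lifted W ⟩
    (f̃ 0 ⊛^ N ⊛ ã (Q ∸ Y)) W                      ≈⟨ reflexive (≡.cong (f̃ 0 ⊛^ N ⊛ ã (Q ∸ Y)) W≡N+[Q∸Y]) ⟩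
    (f̃ 0 ⊛^ N ⊛ ã (Q ∸ Y)) (N ℕ.+ (Q ∸ Y))        ≈⟨ ⊛-top (^-degree N (f̃-degree 0)) (proj₁ (ã-homogeneous (Q ∸ Y))) ⟩
    (f̃ 0 ⊛^ N) N * ã (Q ∸ Y) (Q ∸ Y)              ≈⟨ *-cong (trans (^-top N (f̃-degree 0)) (^-congˡ N (f̃-top 0)))
                                                             (proj₂ (ã-homogeneous (Q ∸ Y))) ⟩
    f 0 ^ N * a (Q ∸ Y)                           ∎
    where
    open FiniteProducts R using (∏-cong)
    open import Algebra.Properties.Semiring.Exp semiring using (^-congˡ)
    Q : ℕ
    Q = q ℕ.^ k
    d : Fin s → ℕ
    d i = Q ∸ q ℕ.^ e i
    N : ℕ
    N = (s ∸ 1) ℕ.* Q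
    Y : ℕ
    Y = sumFinℕ s (λ i → q ℕ.^ e i)
    W : ℕ
    W = sumFinℕ s d
    lifted : prodFin powerSeriesRing s (ã ∘ d) ≋ f̃ 0 ⊛^ N ⊛ ã (Q ∸ Y)
    lifted = InvertibleCase.product-formula powerSeriesRing p-prime 1≤m
               (SeriesFrobenius.series-characteristic R p-prime ιp≈0) f̃ {c̃} f̃₀c̃≈1 k 1≤k ã ã-equation s 1≤s s<q e e<k
    W≡N+[Q∸Y] : W ≡ N ℕ.+ (Q ∸ Y)
    W≡N+[Q∸Y] = sumFinℕ-complement′ Q s (λ i → q ℕ.^ e i) 1≤s (λ i → ℕ.<⇒≤ (ℕ.^-monoʳ-< q 1<q (e<k i)))
                  (ℕ.<⇒≤ (sumFinℕ-powers< 1≤k s<q e e<k))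

open import Data.Nat using (_+_; _*_; _^_)

theorem4 : ∀ {c ℓ} (R : CommutativeRing c ℓ) → IsFieldR R →
    (p m q : ℕ) → Prime p → 1 ≤ m → q ≡ p ^ m →
    HasSubfieldOfSize R q →
    (f : ℕ → CommutativeRing.Carrier R) →
    (a : ℕ → CommutativeRing.Carrier R) →
    (∀ n → CommutativeRing._≈_ R (_⋆_ R a (oneMinus R (qSeries R q f)) n) (zDeriv R (qSeries R q f) n)) →
    (s k : ℕ) → 1 ≤ s → s < q → 1 ≤ k →
    (ks : Fin s → ℕ) → (∀ i → ks i < k) →
    CommutativeRing._≈_ R
      (prodFin R s (λ i → a (q ^ k ∸ q ^ ks i)))
      (CommutativeRing._*_ R (pow R (f 0) ((s ∸ 1) * q ^ k)) (a (q ^ k ∸ sumFinℕ s (λ i → q ^ ks i))))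
theorem4 R isField p m .(p ^ m) p-prime 1≤m ≡.refl subfield f a a⋆[1-F]≈zF s k 1≤s s<q 1≤k ks ks<k =
  trans (Homogenization.product-formula R p-prime 1≤m ιp≈0 f a a-equation s k 1≤s s<q 1≤k ks ks<k)
        (*-congʳ (reflexive (≡.sym (RingLemmas.pow≡^ R (f 0) ((s ∸ 1) * (p ^ m) ^ k)))))
  where
  open CommutativeRing R using (_≈_; 0#; trans; reflexive; *-congʳ)
  ιp≈0 : ι R p ≈ 0#
  ιp≈0 = RingLemmas.characteristic R isField subfield p m ≡.refl
  a-equation : ∀ n → _⋆_ R a (oneMinus R (qSeries R (p ^ m) f)) n ≈ PowerSeries.monomial R (f 0) 1 n
  a-equation n = trans (a⋆[1-F]≈zF n) (QSeriesPowers.zDeriv-qSeries R p-prime 1≤m ιp≈0 f n)
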